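{- Let $Q$ be a finite set, $\rho:Q\to\mathbb{N}$, $m=\max\rho$, and let $0\le k\le m$. The applicative structure $\mathcal{D}^k=(\mathcal{D}^k_A)_A$ described in the context, with $Y^A$ interpreted as $\mathrm{fix}^k_A$ and every other constant interpreted by an element of $\mathcal{D}^k$ of the corresponding type, is a model of the $\lambda Y$-calculus: (i) for every term $M$ of type $A$ and every valuation $\nu$ mapping each free variable of type $B$ of $M$ to an element of $\mathcal{D}^k_B$, the interpretation $[\![M]\!]^k_\nu$ (variables via $\nu$, application as function application, $\lambda x.M$ as $p\mapsto[\![M]\!]^k_{\nu[p/x]}$) is an element of $\mathcal{D}^k_A$; and (ii) if $M=_{\beta\delta}N$ then $[\![M]\!]^k_\nu=[\![N]\!]^k_\nu$ for every valuation $\nu$.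
   Context: Simple types over base type $o$; $\lambda Y$-terms are simply typed $\lambda$-terms with constants including $Y^A:(A\to A)\to A$; $=_{\beta\delta}$ is generated by $(\lambda x.M)N=M[x:=N]$ and $YM=M(YM)$. Let $Q_k=\{q:\rho(q)=k\}$, $Q_{\le k}=\{q:\rho(q)\le k\}$. Define $\mathcal{D}^0_o=\mathcal{P}(Q_0)$, $\mathcal{D}^0_{A\to B}$ = all monotone maps $\mathcal{D}^0_A\to\mathcal{D}^0_B$; for $k>0$: $\mathcal{D}^k_o=\mathcal{P}(Q_{\le k})$, $\mathcal{L}^k_o=\{(R,P)\in\mathcal{D}^{k-1}_o\times\mathcal{D}^k_o: R=P\cap Q_{\le k-1}\}$, $\mathcal{L}^k_{A\to B}=\{(f_1,f_2): f_1\in\mathcal{D}^{k-1}_{A\to B}$, $f_2$ a monotone map $\mathcal{D}^k_A\to\mathcal{D}^k_B$, with $(f_1(g_1),f_2(g_2))\in\mathcal{L}^k_B$ for all $(g_1,g_2)\in\mathcal{L}^k_A\}$, and $\mathcal{D}^k_{A\to B}=\{f_2:\exists f_1,(f_1,f_2)\in\mathcal{L}^k_{A\to B}\}$. Orders: inclusion at $o$, pointwise at arrow types. Each $\mathcal{D}^k_A$ is a finite lattice with greatest element $\top^k_A$; for $k>0$ each $e\in\mathcal{D}^k_A$ has a unique $e^\downarrow\in\mathcal{D}^{k-1}_A$ with $(e^\downarrow,e)\in\mathcal{L}^k_A$, and for $d\in\mathcal{D}^{k-1}_A$ the set $\{e:(d,e)\in\mathcal{L}^k_A\}$ has a greatest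 element $d^{\uparrow\top}$ and least element $d^{\uparrow\bot}$. Fixpoints: $\mathrm{fix}^0_A(f)=\bigwedge_{n\ge0}f^n(\top^0_A)$; for $2k>0$, $f\in\mathcal{D}^{2k}_{A\to A}$: $\mathrm{fix}^{2k}_A(f)=\bigwedge_{n}f^n((\mathrm{fix}^{2k-1}_A(f^\downarrow))^{\uparrow\top})$; for $f\in\mathcal{D}^{2k+1}_{A\to A}$: $\mathrm{fix}^{2k+1}_A(f)=\bigvee_n f^n((\mathrm{fix}^{2k}_A(f^\downarrow))^{\uparrow\bot})$. -}

module Defs where

open import Data.Nat using (ℕ; zero; suc; _≤_; _⊔_)
open import Data.Bool using (Bool; true; false; not; if_then_else_)
open import Data.Fin using (Fin)
open import Data.Fin.Subset using (Subset; _∈_; _⊆_)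
open import Data.List using (List; []; _∷_; foldr; map; allFin)
open import Data.Product using (Σ; _×_; _,_)
open import Function.Bundles using (_⇔_)
open import Relation.Binary.PropositionalEquality using (_≡_)

infixr 7 _⇒_
data Ty : Set where
  o   : Ty
  _⇒_ : Ty → Ty → Ty

-- m = max ρ  (Q = Fin n; max of the empty family is 0)
maxρ : (n : ℕ) → (Fin n → ℕ) → ℕ
maxρ n ρ = foldr _⊔_ 0 (map ρ (allFin n))

isEven : ℕ → Bool
isEven zero    = true
isEven (suc k) = not (isEven k)

-- The semantic domains D^k_A, carved out of an ambient type Sem A
-- (Sem o = subsets of Q, Sem (A ⇒ B) = all functions).

Sem : ℕ → Ty → Set
Sem n o       = Subset n
Sem n (A ⇒ B) = Sem n A → Sem n B

module Model (n : ℕ) (ρ : Fin n → ℕ) where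

  mutual
    D : ℕ → (A : Ty) → Sem n A → Set
    D k o P               = ∀ q → q ∈ P → ρ q ≤ k
    D zero (A ⇒ B) f      = MonoMap zero A B f
    D (suc k) (A ⇒ B) f₂  = Σ (Sem n (A ⇒ B)) (λ f₁ → L k (A ⇒ B) f₁ f₂)

    -- L k A x y  :  (x , y) ∈ L^{k+1}_A
    L : ℕ → (A : Ty) → Sem n A → Sem n A → Set
    L k o R P = D k o R × D (suc k) o P
                × (∀ q → (q ∈ R) ⇔ (q ∈ P × ρ q ≤ k))
    L k (A ⇒ B) f₁ f₂ = D k (A ⇒ B) f₁ × MonoMap (suc k) A B f₂
                × (∀ g₁ g₂ → L k A g₁ g₂ → L k B (f₁ g₁) (f₂ g₂))

    MonoMap : ℕ → (A B : Ty) → Sem n (A ⇒ B) → Set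
    MonoMap k A B f = (∀ x → D k A x → D k B (f x))
                    × (∀ x y → D k A x → D k A y → Le k A x y → Le k B (f x) (f y))

    Le : ℕ → (A : Ty) → Sem n A → Sem n A → Set
    Le k o P P'       = P ⊆ P'
    Le k (A ⇒ B) f g  = ∀ x → D k A x → Le k B (f x) (g x)

  Eq : ℕ → (A : Ty) → Sem n A → Sem n A → Set
  Eq k o P P'      = P ≡ P'
  Eq k (A ⇒ B) f g = ∀ x → D k A x → Eq k B (f x) (g x)

  IsTop : ℕ → (A : Ty) → Sem n A → Set
  IsTop k A t = D k A t × (∀ x → D k A x → Le k A x t)

  IsUpTop : ℕ → (A : Ty) → Sem n A → Sem n A → Set
  IsUpTop j A d z = L j A d z × (∀ e → L j A d e → Le (suc j) A e z)

  IsUpBot : ℕ → (A : Ty) → Sem n A → Sem n A → Set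
  IsUpBot j A d z = L j A d z × (∀ e → L j A d e → Le (suc j) A z e)

  IsGLB : ℕ → (A : Ty) → (ℕ → Sem n A) → Sem n A → Set
  IsGLB k A s x = D k A x × (∀ i → Le k A x (s i))
                × (∀ y → D k A y → (∀ i → Le k A y (s i)) → Le k A y x)

  IsLUB : ℕ → (A : Ty) → (ℕ → Sem n A) → Sem n A → Set
  IsLUB k A s x = D k A x × (∀ i → Le k A (s i) x)
                × (∀ y → D k A y → (∀ i → Le k A (s i) y) → Le k A x y)

  iter : {A : Ty} → (Sem n A → Sem n A) → ℕ → Sem n A → Sem n A
  iter f zero    x = x
  iter f (suc i) x = f (iter f i x)

  IsFix : ℕ → (A : Ty) → Sem n (A ⇒ A) → Sem n A → Set
  IsFix zero A f x =
    Σ (Sem n A) λ t → IsTop zero A t × IsGLB zero A (λ i → iter f i t) x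
  IsFix (suc j) A f x =
    Σ (Sem n (A ⇒ A)) λ f↓ → L j (A ⇒ A) f↓ f ×
    Σ (Sem n A) λ y → IsFix j A f↓ y ×
    (if isEven (suc j)
      then (Σ (Sem n A) λ z → IsUpTop j A y z × IsGLB (suc j) A (λ i → iter f i z) x)
      else (Σ (Sem n A) λ z → IsUpBot j A y z × IsLUB (suc j) A (λ i → iter f i z) x))

  YSpec : ℕ → ((A : Ty) → Sem n (A ⇒ A) → Sem n A) → Set
  YSpec k Yint = ∀ A f → D k (A ⇒ A) f → IsFix k A f (Yint A f)

infix 4 _∋_
data _∋_ : List Ty → Ty → Set where
  here  : ∀ {Γ A} → (A ∷ Γ) ∋ A
  there : ∀ {Γ A B} → Γ ∋ A → (B ∷ Γ) ∋ A

module Syntax (Const : Set) (cty : Const → Ty) where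

  data Tm (Γ : List Ty) : Ty → Set where
    var : ∀ {A} → Γ ∋ A → Tm Γ A
    con : (c : Const) → Tm Γ (cty c)
    Y   : (A : Ty) → Tm Γ ((A ⇒ A) ⇒ A)
    app : ∀ {A B} → Tm Γ (A ⇒ B) → Tm Γ A → Tm Γ B
    lam : ∀ {A B} → Tm (A ∷ Γ) B → Tm Γ (A ⇒ B)

  Ren : List Ty → List Ty → Set
  Ren Γ Δ = ∀ {A} → Γ ∋ A → Δ ∋ A

  extR : ∀ {Γ Δ B} → Ren Γ Δ → Ren (B ∷ Γ) (B ∷ Δ)
  extR r here      = here
  extR r (there x) = there (r x)

  rename : ∀ {Γ Δ A} → Ren Γ Δ → Tm Γ A → Tm Δ A
  rename r (var x)   = var (r x)
  rename r (con c)   = con c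
  rename r (Y A)     = Y A
  rename r (app M N) = app (rename r M) (rename r N)
  rename r (lam M)   = lam (rename (extR r) M)

  Sub : List Ty → List Ty → Set
  Sub Γ Δ = ∀ {A} → Γ ∋ A → Tm Δ A

  extS : ∀ {Γ Δ B} → Sub Γ Δ → Sub (B ∷ Γ) (B ∷ Δ)
  extS s here      = var here
  extS s (there x) = rename there (s x)

  subst : ∀ {Γ Δ A} → Sub Γ Δ → Tm Γ A → Tm Δ A
  subst s (var x)   = s x
  subst s (con c)   = con c
  subst s (Y A)     = Y A
  subst s (app M N) = app (subst s M) (subst s N)
  subst s (lam M)   = lam (subst (extS s) M)

  single : ∀ {Γ B} → Tm Γ B → Sub (B ∷ Γ) Γ
  single N here      = N
  single N (there x) = var x

  _[_] : ∀ {Γ A B} → Tm (B ∷ Γ) A → Tm Γ B → Tm Γ A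
  M [ N ] = subst (single N) M

  infix 4 _=βδ_
  data _=βδ_ {Γ : List Ty} : ∀ {A} → Tm Γ A → Tm Γ A → Set where
    β      : ∀ {A B} (M : Tm (A ∷ Γ) B) (N : Tm Γ A) → app (lam M) N =βδ M [ N ]
    δ      : ∀ {A} (M : Tm Γ (A ⇒ A)) → app (Y A) M =βδ app M (app (Y A) M)
    refl   : ∀ {A} {M : Tm Γ A} → M =βδ M
    sym    : ∀ {A} {M N : Tm Γ A} → M =βδ N → N =βδ M
    trans  : ∀ {A} {M N P : Tm Γ A} → M =βδ N → N =βδ P → M =βδ P
    appCong : ∀ {A B} {M M' : Tm Γ (A ⇒ B)} {N N' : Tm Γ A}
            → M =βδ M' → N =βδ N' → app M N =βδ app M' N'
    lamCong : ∀ {A B} {M M' : Tm (A ∷ Γ) B} → M =βδ M' → lam M =βδ lam M'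

module Interp (n : ℕ) (Const : Set) (cty : Const → Ty)
              (cint : (c : Const) → Sem n (cty c))
              (Yint : (A : Ty) → Sem n ((A ⇒ A) ⇒ A)) where
  open Syntax Const cty

  Env : List Ty → Set
  Env Γ = ∀ {A} → Γ ∋ A → Sem n A

  _▸_ : ∀ {Γ A} → Env Γ → Sem n A → Env (A ∷ Γ)
  (ν ▸ p) here      = p
  (ν ▸ p) (there x) = ν x

  ⟦_⟧ : ∀ {Γ A} → Tm Γ A → Env Γ → Sem n A
  ⟦ var x ⟧   ν = ν x
  ⟦ con c ⟧   ν = cint c
  ⟦ Y A ⟧     ν = Yint A
  ⟦ app M N ⟧ ν = ⟦ M ⟧ ν (⟦ N ⟧ ν)
  ⟦ lam M ⟧   ν = λ p → ⟦ M ⟧ (ν ▸ p)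

module Submission where

-- Levels are linked by the
-- operations e ↦ e↓ and d ↦ d↑⊤, d↑⊥, defined explicitly on all of Sem; they are
-- monotone and characterise L: (d , e) ∈ L^{j+1} iff d ≈ e↓ iff d↑⊥ ≤ e ≤ d↑⊤.
-- Each D^k_A is finite up to Eq: an explicit enumeration by Fin (size A) (step
-- functions, clamped into the right L-fibre above level 0) yields a measure that is
-- strictly monotone, so the iterates defining fix^k_A, a descending chain from ⊤ or
-- d↑⊤ and an ascending one from d↑⊥, stabilise at the required glb/lub after a bounded
-- number of steps.  Hence fix^k exists, is unique up to Eq, is a monotone fixpoint
-- operator, and (fix^j f₁ , fix^{j+1} f₂) ∈ L whenever (f₁ , f₂) ∈ L, so fix^k ∈ D^k.
-- Interpretations of terms stay in D^k by a logical relation: at level j+1 the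
-- interpretation is L-related to the level-j one with constants c↓.  Soundness of β
-- is the substitution lemma, and of δ the fixpoint equation.

open import Defs
open import Data.Bool using (Bool; true; false; if_then_else_)
open import Data.Fin using (Fin; zero; suc; funToFin; finToFun; combine)
open import Data.Fin.Properties using (finToFun-funToFin; 2↔Bool; all?)
open import Data.Fin.Subset using (Subset; _∈_; _∉_; _⊆_; ∣_∣; _∩_; _∪_) renaming (⊥ to ∅)
open import Data.Fin.Subset.Properties
  using (_∈?_; _⊆?_; ⊆-antisym; ∉⊥; p⊆q⇒∣p∣≤∣q∣; p⊂q⇒∣p∣<∣q∣; x∈p∪q⁻; x∈p∪q⁺; x∈p∩q⁻; x∈p∩q⁺;
         p∩q⊆p; p∩q⊆q; p⊆p∪q; q⊆p∪q; ∩-distribʳ-∪)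
open import Data.List using (List; _∷_)
open import Data.Nat using (ℕ; zero; suc; _≤_; _+_; _∸_; _^_; z≤n; s≤s)
import Data.Nat.Properties as ℕ
open import Data.Product using (Σ; _×_; _,_; proj₁; proj₂)
open import Data.Sum using (inj₁; inj₂)
open import Data.Vec using (tabulate; lookup)
open import Data.Vec.Properties using ([]=⇒lookup; lookup⇒[]=; lookup∘tabulate; tabulate∘lookup; tabulate-cong)
open import Function.Base using (_∘_)
open import Function.Bundles using (Inverse; _⇔_; mk⇔; Equivalence)
open import Level using (0ℓ)
open import Relation.Binary.Bundles using (Poset)
open import Relation.Binary.PropositionalEquality as ≡ using (_≡_; refl; sym; trans; cong; cong₂)
import Relation.Binary.Reasoning.PartialOrder
open import Relation.Nullary using (Dec; yes; no; does; contradiction)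
open import Relation.Nullary.Decidable using (dec-true)
open import Relation.Unary using (Pred; Decidable)

module _ {n : ℕ} {P : Pred (Fin n) 0ℓ} (P? : Decidable P) where

  select : Subset n
  select = tabulate (λ q → does (P? q))

  ∈-select⁻ : ∀ {q} → q ∈ select → P q
  ∈-select⁻ {q} q∈ with P? q | trans (sym (lookup∘tabulate (λ q → does (P? q)) q)) ([]=⇒lookup q∈)
  ... | yes p | _ = p

  ∈-select⁺ : ∀ {q} → P q → q ∈ select
  ∈-select⁺ {q} p = lookup⇒[]= q select (trans (lookup∘tabulate _ q) (dec-true (P? q) p))

⊆∧∣≡∣⇒⊇ : ∀ {n} {p q : Subset n} → p ⊆ q → ∣ p ∣ ≡ ∣ q ∣ → q ⊆ p
⊆∧∣≡∣⇒⊇ {p = p} p⊆q eq {x} x∈q with x ∈? p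
... | yes x∈p = x∈p
... | no x∉p = contradiction eq (ℕ.<⇒≢ (p⊂q⇒∣p∣<∣q∣ (p⊆q , x , x∈q , x∉p)))

∩-distribʳ-∩ : ∀ {n} (Q P P′ : Subset n) → (P ∩ P′) ∩ Q ≡ (P ∩ Q) ∩ (P′ ∩ Q)
∩-distribʳ-∩ Q P P′ = ⊆-antisym
  (λ q∈ → let (q∈PP′ , q∈Q) = x∈p∩q⁻ (P ∩ P′) Q q∈ ; (q∈P , q∈P′) = x∈p∩q⁻ P P′ q∈PP′
          in x∈p∩q⁺ (x∈p∩q⁺ (q∈P , q∈Q) , x∈p∩q⁺ (q∈P′ , q∈Q)))
  (λ q∈ → let (q∈PQ , q∈P′Q) = x∈p∩q⁻ (P ∩ Q) (P′ ∩ Q) q∈ ; (q∈P , q∈Q) = x∈p∩q⁻ P Q q∈PQ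
          in x∈p∩q⁺ (x∈p∩q⁺ (q∈P , proj₁ (x∈p∩q⁻ P′ Q q∈P′Q)) , q∈Q))

∪-mono : ∀ {n} {P P′ R R′ : Subset n} → P ⊆ R → P′ ⊆ R′ → P ∪ P′ ⊆ R ∪ R′
∪-mono {P = P} {P′} P⊆R P′⊆R′ q∈ with x∈p∪q⁻ P P′ q∈
... | inj₁ q∈P = x∈p∪q⁺ (inj₁ (P⊆R q∈P))
... | inj₂ q∈P′ = x∈p∪q⁺ (inj₂ (P′⊆R′ q∈P′))

∩-mono : ∀ {n} {P P′ R R′ : Subset n} → P ⊆ R → P′ ⊆ R′ → P ∩ P′ ⊆ R ∩ R′
∩-mono {P = P} {P′} P⊆R P′⊆R′ q∈ =
  let (q∈P , q∈P′) = x∈p∩q⁻ P P′ q∈ in x∈p∩q⁺ (P⊆R q∈P , P′⊆R′ q∈P′)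

funToFin-cong : ∀ {m n} {f g : Fin m → Fin n} → (∀ i → f i ≡ g i) → funToFin f ≡ funToFin g
funToFin-cong {zero}  f≗g = refl
funToFin-cong {suc m} f≗g = cong₂ combine (f≗g zero) (funToFin-cong (λ i → f≗g (suc i)))

module SubsetCode {n : ℕ} where
  open Inverse 2↔Bool

  encode : Subset n → Fin (2 ^ n)
  encode p = funToFin (λ q → from (lookup p q))

  decode : Fin (2 ^ n) → Subset n
  decode c = tabulate (λ q → to (finToFun c q))

  decode-encode : ∀ p → decode (encode p) ≡ p
  decode-encode p = trans
    (tabulate-cong (λ q → trans (cong to (finToFun-funToFin _ q)) (strictlyInverseˡ (lookup p q))))
    (tabulate∘lookup p)

sumᶠ : ∀ m → (Fin m → ℕ) → ℕ
sumᶠ zero    f = 0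
sumᶠ (suc m) f = f zero + sumᶠ m (λ i → f (suc i))

sumᶠ-mono : ∀ m {f g : Fin m → ℕ} → (∀ i → f i ≤ g i) → sumᶠ m f ≤ sumᶠ m g
sumᶠ-mono zero    f≤g = z≤n
sumᶠ-mono (suc m) f≤g = ℕ.+-mono-≤ (f≤g zero) (sumᶠ-mono m (λ i → f≤g (suc i)))

sumᶠ-≡⇒≡ : ∀ m {f g : Fin m → ℕ} → (∀ i → f i ≤ g i) → sumᶠ m f ≡ sumᶠ m g →
            ∀ i → f i ≡ g i
sumᶠ-≡⇒≡ (suc m) {f} {g} f≤g eq = f≡g
  where
  tail≤ = sumᶠ-mono m (λ i → f≤g (suc i))
  head≡ : f zero ≡ g zero
  head≡ = ℕ.≤-antisym (f≤g zero)
    (ℕ.+-cancelʳ-≤ _ _ _ (ℕ.≤-trans (ℕ.≤-reflexive (sym eq)) (ℕ.+-monoʳ-≤ (f zero) tail≤)))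
  tail≡ : sumᶠ m (λ i → f (suc i)) ≡ sumᶠ m (λ i → g (suc i))
  tail≡ = ℕ.+-cancelˡ-≡ (f zero) _ _ (trans eq (cong (_+ _) (sym head≡)))
  f≡g : ∀ i → f i ≡ g i
  f≡g zero    = head≡
  f≡g (suc i) = sumᶠ-≡⇒≡ m (λ i → f≤g (suc i)) tail≡ i

module Stabilisation {X : Set} (_≲_ : X → X → Set)
  (≲-refl : ∀ {x} → x ≲ x) (≲-trans : ∀ {x y z} → x ≲ y → y ≲ z → x ≲ z)
  (measure : X → ℕ) (s : ℕ → X)
  (descending : ∀ i → s (suc i) ≲ s i)
  (measure-descending : ∀ i → measure (s (suc i)) ≤ measure (s i))
  (measure-≡⇒stable : ∀ i → measure (s (suc i)) ≡ measure (s i) → s i ≲ s (suc i))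
  (stable-step : ∀ i → s i ≲ s (suc i) → s (suc i) ≲ s (suc (suc i)))
  where

  Stable : ℕ → Set
  Stable i = s i ≲ s (suc i)

  stable-from : ∀ {i} → Stable i → ∀ d → Stable (d + i)
  stable-from st zero    = st
  stable-from st (suc d) = stable-step _ (stable-from st d)

  -- Each unstable step strictly decreases the measure.
  some-stable : ∀ c i → measure (s i) ≤ c → Σ ℕ λ j → j ≤ i + c × Stable j
  some-stable c i h with measure (s (suc i)) ℕ.≟ measure (s i)
  ... | yes eq = i , ℕ.m≤m+n i c , measure-≡⇒stable i eq
  ... | no neq with c | ℕ.<-≤-trans (ℕ.≤∧≢⇒< (measure-descending i) neq) h
  ...   | suc c | s≤s h' with some-stable c (suc i) h'
  ...     | j , j≤ , st = j , ℕ.≤-trans j≤ (ℕ.≤-reflexive (sym (ℕ.+-suc i c))) , st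

  stable-after : ∀ N → measure (s 0) ≤ N → Stable N
  stable-after N h with some-stable (measure (s 0)) 0 ℕ.≤-refl
  ... | j , j≤ , st = ≡.subst Stable (ℕ.m∸n+n≡m (ℕ.≤-trans j≤ h)) (stable-from st (N ∸ j))

  descending-chain : ∀ d i → s (d + i) ≲ s i
  descending-chain zero    i = ≲-refl
  descending-chain (suc d) i = ≲-trans (descending (d + i)) (descending-chain d i)

  stable-chain : ∀ {N} → Stable N → ∀ d → s N ≲ s (d + N)
  stable-chain st zero    = ≲-refl
  stable-chain st (suc d) = ≲-trans (stable-chain st d) (stable-from st d)

  limit-below : ∀ N → measure (s 0) ≤ N → ∀ i → s N ≲ s i
  limit-below N h i with ℕ.≤-total i N
  ... | inj₁ i≤N = ≡.subst (λ m → s m ≲ s i) (ℕ.m∸n+n≡m i≤N) (descending-chain (N ∸ i) i)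
  ... | inj₂ N≤i = ≡.subst (λ m → s N ≲ s m) (ℕ.m∸n+n≡m N≤i) (stable-chain (stable-after N h) (i ∸ N))

module Domain (n : ℕ) (ρ : Fin n → ℕ) where
  open Model n ρ

  Le-refl : ∀ k A x → Le k A x x
  Le-refl k o       x = λ x∈ → x∈
  Le-refl k (A ⇒ B) f = λ x _ → Le-refl k B (f x)

  Le-trans : ∀ k A {x y z} → Le k A x y → Le k A y z → Le k A x z
  Le-trans k o       x≤y y≤z = λ q∈ → y≤z (x≤y q∈)
  Le-trans k (A ⇒ B) f≤g g≤h = λ x dx → Le-trans k B (f≤g x dx) (g≤h x dx)

  Le-antisym : ∀ k A {x y} → Le k A x y → Le k A y x → Eq k A x y
  Le-antisym k o       x≤y y≤x = ⊆-antisym x≤y y≤x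
  Le-antisym k (A ⇒ B) f≤g g≤f = λ x dx → Le-antisym k B (f≤g x dx) (g≤f x dx)

  Eq-refl : ∀ k A x → Eq k A x x
  Eq-refl k o       x = refl
  Eq-refl k (A ⇒ B) f = λ x _ → Eq-refl k B (f x)

  Eq-sym : ∀ k A {x y} → Eq k A x y → Eq k A y x
  Eq-sym k o       eq = sym eq
  Eq-sym k (A ⇒ B) eq = λ x dx → Eq-sym k B (eq x dx)

  Eq-trans : ∀ k A {x y z} → Eq k A x y → Eq k A y z → Eq k A x z
  Eq-trans k o       eq eq′ = trans eq eq′
  Eq-trans k (A ⇒ B) eq eq′ = λ x dx → Eq-trans k B (eq x dx) (eq′ x dx)

  Eq⇒Le : ∀ k A {x y} → Eq k A x y → Le k A x y
  Eq⇒Le k o       refl = λ x∈ → x∈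
  Eq⇒Le k (A ⇒ B) eq   = λ x dx → Eq⇒Le k B (eq x dx)

  Eq⇒Ge : ∀ k A {x y} → Eq k A x y → Le k A y x
  Eq⇒Ge k A eq = Eq⇒Le k A (Eq-sym k A eq)

  poset : ℕ → Ty → Poset 0ℓ 0ℓ 0ℓ
  poset k A = record
    { Carrier        = Sem n A
    ; _≈_            = Eq k A
    ; _≤_            = Le k A
    ; isPartialOrder = record
      { isPreorder = record
        { isEquivalence = record { refl = Eq-refl k A _ ; sym = Eq-sym k A ; trans = Eq-trans k A }
        ; reflexive     = Eq⇒Le k A
        ; trans         = Le-trans k A
        }
      ; antisym    = Le-antisym k A
      }
    }

  module Le-Reasoning k A = Relation.Binary.Reasoning.PartialOrder (poset k A)

  D⇒MonoMap : ∀ k A B {f} → D k (A ⇒ B) f → MonoMap k A B f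
  D⇒MonoMap zero    A B df               = df
  D⇒MonoMap (suc k) A B (_ , _ , mf , _) = mf

  app-D : ∀ k A B {f x} → D k (A ⇒ B) f → D k A x → D k B (f x)
  app-D k A B df dx = proj₁ (D⇒MonoMap k A B df) _ dx

  app-Le : ∀ k A B {f x y} → D k (A ⇒ B) f → D k A x → D k A y → Le k A x y → Le k B (f x) (f y)
  app-Le k A B df dx dy = proj₂ (D⇒MonoMap k A B df) _ _ dx dy

  app-Eq : ∀ k A B {f x y} → D k (A ⇒ B) f → D k A x → D k A y → Eq k A x y → Eq k B (f x) (f y)
  app-Eq k A B df dx dy eq =
    Le-antisym k B (app-Le k A B df dx dy (Eq⇒Le k A eq)) (app-Le k A B df dy dx (Eq⇒Ge k A eq))

  app-cong : ∀ k A B {f f′ x x′} → D k (A ⇒ B) f′ → D k A x → D k A x′ →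
             Eq k (A ⇒ B) f f′ → Eq k A x x′ → Eq k B (f x) (f′ x′)
  app-cong k A B df′ dx dx′ f≈f′ x≈x′ = Eq-trans k B (f≈f′ _ dx) (app-Eq k A B df′ dx dx′ x≈x′)

  L⇒Dˡ : ∀ j A {x y} → L j A x y → D j A x
  L⇒Dˡ j o       l = proj₁ l
  L⇒Dˡ j (A ⇒ B) l = proj₁ l

  L⇒Dʳ : ∀ j A {x y} → L j A x y → D (suc j) A y
  L⇒Dʳ j o       l = proj₁ (proj₂ l)
  L⇒Dʳ j (A ⇒ B) l = _ , l

  L-app : ∀ j A B {f₁ f₂ g₁ g₂} → L j (A ⇒ B) f₁ f₂ → L j A g₁ g₂ → L j B (f₁ g₁) (f₂ g₂)
  L-app j A B (_ , _ , lf) lg = lf _ _ lg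

  mutual
    D-resp-Eq : ∀ k A {x y} → Eq k A x y → D k A x → D k A y
    D-resp-Eq k       o       refl dx       = dx
    D-resp-Eq zero    (A ⇒ B) eq   df       = MonoMap-resp-Eq zero A B eq df
    D-resp-Eq (suc k) (A ⇒ B) eq   (f₁ , l) = f₁ , Lʳ-resp-Eq k (A ⇒ B) eq l

    MonoMap-resp-Eq : ∀ k A B {f g} → Eq k (A ⇒ B) f g → MonoMap k A B f → MonoMap k A B g
    MonoMap-resp-Eq k A B eq (f-D , f-Le) =
      (λ x dx → D-resp-Eq k B (eq x dx) (f-D x dx)) ,
      (λ x y dx dy x≤y → Le-trans k B (Eq⇒Ge k B (eq x dx))
                           (Le-trans k B (f-Le x y dx dy x≤y) (Eq⇒Le k B (eq y dy))))

    Lʳ-resp-Eq : ∀ j A {x y y′} → Eq (suc j) A y y′ → L j A x y → L j A x y′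
    Lʳ-resp-Eq j o       refl l              = l
    Lʳ-resp-Eq j (A ⇒ B) eq   (df , mf , lf) =
      df , MonoMap-resp-Eq (suc j) A B eq mf ,
      λ g₁ g₂ lg → Lʳ-resp-Eq j B (eq g₂ (L⇒Dʳ j A lg)) (lf g₁ g₂ lg)

  Lˡ-resp-Eq : ∀ j A {x x′ y} → Eq j A x x′ → L j A x y → L j A x′ y
  Lˡ-resp-Eq j o       refl l              = l
  Lˡ-resp-Eq j (A ⇒ B) eq   (df , mf , lf) =
    D-resp-Eq j (A ⇒ B) eq df , mf ,
    λ g₁ g₂ lg → Lˡ-resp-Eq j B (eq g₁ (L⇒Dˡ j A lg)) (lf g₁ g₂ lg)

  Q≤ : ℕ → Subset n
  Q≤ k = select (λ q → ρ q ℕ.≤? k)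

  Q≡ : ℕ → Subset n
  Q≡ k = select (λ q → ρ q ℕ.≟ k)

  ∈Q≤⁻ : ∀ {k q} → q ∈ Q≤ k → ρ q ≤ k
  ∈Q≤⁻ {k} = ∈-select⁻ (λ q → ρ q ℕ.≤? k)

  ∈Q≤⁺ : ∀ {k q} → ρ q ≤ k → q ∈ Q≤ k
  ∈Q≤⁺ {k} = ∈-select⁺ (λ q → ρ q ℕ.≤? k)

  ∈Q≡⁻ : ∀ {k q} → q ∈ Q≡ k → ρ q ≡ k
  ∈Q≡⁻ {k} = ∈-select⁻ (λ q → ρ q ℕ.≟ k)

  ∈Q≡⁺ : ∀ {k q} → ρ q ≡ k → q ∈ Q≡ k
  ∈Q≡⁺ {k} = ∈-select⁺ (λ q → ρ q ℕ.≟ k)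

  -- down j A e = e↓ and up b j A d = d↑⊤ (b = true) or d↑⊥ (b = false), extended to
  -- all of Sem; at arrow types the argument is moved to the other level first.
  mutual
    down : ∀ j A → Sem n A → Sem n A
    down j o       P = P ∩ Q≤ j
    down j (A ⇒ B) f = λ g → down j B (f (up true j A g))

    up : Bool → ∀ j A → Sem n A → Sem n A
    up b     j (A ⇒ B) f = λ g → up b j B (f (down j A g))
    up true  j o       R = R ∪ Q≡ (suc j)
    up false j o       R = R

  ρ≤⇒∉Q≡suc : ∀ {j q} → ρ q ≤ j → q ∉ Q≡ (suc j)
  ρ≤⇒∉Q≡suc ρq≤j q∈ = ℕ.<-irrefl (∈Q≡⁻ q∈) (s≤s ρq≤j)

  mutual
    L-up : ∀ b j A {d} → D j A d → L j A d (up b j A d)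
    L-up true j o {R} dR = dR , up-D , R⇔
      where
      up-D : D (suc j) o (R ∪ Q≡ (suc j))
      up-D q q∈ with x∈p∪q⁻ R (Q≡ (suc j)) q∈
      ... | inj₁ q∈R = ℕ.m≤n⇒m≤1+n (dR q q∈R)
      ... | inj₂ q∈Q = ℕ.≤-reflexive (∈Q≡⁻ q∈Q)
      below : ∀ {q} → q ∈ R ∪ Q≡ (suc j) × ρ q ≤ j → q ∈ R
      below (q∈ , ρq≤j) with x∈p∪q⁻ R (Q≡ (suc j)) q∈
      ... | inj₁ q∈R = q∈R
      ... | inj₂ q∈Q = contradiction q∈Q (ρ≤⇒∉Q≡suc ρq≤j)
      R⇔ : ∀ q → (q ∈ R) ⇔ (q ∈ R ∪ Q≡ (suc j) × ρ q ≤ j)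
      R⇔ q = mk⇔ (λ q∈R → x∈p∪q⁺ (inj₁ q∈R) , dR q q∈R) below
    L-up false j o {R} dR =
      dR , (λ q q∈ → ℕ.m≤n⇒m≤1+n (dR q q∈)) , λ q → mk⇔ (λ q∈ → q∈ , dR q q∈) proj₁
    L-up b j (A ⇒ B) {d} dd =
      dd , ((λ g dg → L⇒Dʳ j B (L-up b j B (app-D j A B dd (down-D j A dg)))) ,
            (λ g g′ dg dg′ g≤g′ →
               up-mono b j B (app-Le j A B dd (down-D j A dg) (down-D j A dg′) (down-mono j A g≤g′)))) ,
      λ g₁ g₂ lg → L-via-down j A B dd lg (L-up b j B (app-D j A B dd (down-D j A (L⇒Dʳ j A lg))))

    up⊤-greatest : ∀ j A {d e} → L j A d e → Le (suc j) A e (up true j A d)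
    up⊤-greatest j o {d} (dd , de , d⇔) {q} q∈e with ρ q ℕ.≤? j
    ... | yes ρq≤j = x∈p∪q⁺ (inj₁ (Equivalence.from (d⇔ q) (q∈e , ρq≤j)))
    ... | no ρq≰j = x∈p∪q⁺ (inj₂ (∈Q≡⁺ (ℕ.≤-antisym (de q q∈e) (ℕ.≰⇒> ρq≰j))))
    up⊤-greatest j (A ⇒ B) (_ , _ , lf) = λ g dg → up⊤-greatest j B (lf _ g (L-down j A dg))

    L-down : ∀ j A {e} → D (suc j) A e → L j A (down j A e) e
    L-down j o {P} dP = down-D₀ , dP , λ q → mk⇔ (λ q∈ → proj₁ (x∈p∩q⁻ P _ q∈) , down-D₀ q q∈)
                                                  (λ (q∈ , ρq≤j) → x∈p∩q⁺ (q∈ , ∈Q≤⁺ ρq≤j))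
      where
      down-D₀ : D j o (P ∩ Q≤ j)
      down-D₀ q q∈ = ∈Q≤⁻ (proj₂ (x∈p∩q⁻ P _ q∈))
    L-down j (A ⇒ B) (f₁ , lf) =
      Lˡ-resp-Eq j (A ⇒ B) (λ g dg → down-unique j B (L-app j A B lf (L-up true j A dg))) lf

    down-D : ∀ j A {e} → D (suc j) A e → D j A (down j A e)
    down-D j A de = L⇒Dˡ j A (L-down j A de)

    down-unique : ∀ j A {d e} → L j A d e → Eq j A d (down j A e)
    down-unique j o {d} {e} (dd , _ , d⇔) = ⊆-antisym
      (λ {q} q∈d → x∈p∩q⁺ (proj₁ (Equivalence.to (d⇔ q) q∈d) , ∈Q≤⁺ (dd q q∈d)))
      (λ {q} q∈ → let (q∈e , q∈Q) = x∈p∩q⁻ e _ q∈ in Equivalence.from (d⇔ q) (q∈e , ∈Q≤⁻ q∈Q))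
    down-unique j (A ⇒ B) lf = λ g dg → down-unique j B (L-app j A B lf (L-up true j A dg))

    L-via-down : ∀ j A B {f g₁ g₂ e} → D j (A ⇒ B) f → L j A g₁ g₂ →
                 L j B (f (down j A g₂)) e → L j B (f g₁) e
    L-via-down j A B df lg = Lˡ-resp-Eq j B
      (Eq-sym j B (app-Eq j A B df (L⇒Dˡ j A lg) (down-D j A (L⇒Dʳ j A lg)) (down-unique j A lg)))

    down-mono : ∀ j A {e e′} → Le (suc j) A e e′ → Le j A (down j A e) (down j A e′)
    down-mono j o {e} e⊆e′ {q} q∈ = let (q∈e , q∈Q) = x∈p∩q⁻ e _ q∈ in x∈p∩q⁺ (e⊆e′ q∈e , q∈Q)
    down-mono j (A ⇒ B) f≤f′ = λ g dg → down-mono j B (f≤f′ (up true j A g) (L⇒Dʳ j A (L-up true j A dg)))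

    up-mono : ∀ b j A {d d′} → Le j A d d′ → Le (suc j) A (up b j A d) (up b j A d′)
    up-mono true j o {d} d⊆d′ {q} q∈ with x∈p∪q⁻ d _ q∈
    ... | inj₁ q∈d = x∈p∪q⁺ (inj₁ (d⊆d′ q∈d))
    ... | inj₂ q∈Q = x∈p∪q⁺ (inj₂ q∈Q)
    up-mono false j o       d⊆d′ = d⊆d′
    up-mono b     j (A ⇒ B) f≤f′ = λ g dg → up-mono b j B (f≤f′ (down j A g) (down-D j A dg))

  up⊥-least : ∀ j A {d e} → L j A d e → Le (suc j) A (up false j A d) e
  up⊥-least j o       (_ , _ , d⇔) {q} q∈d = proj₁ (Equivalence.to (d⇔ q) q∈d)
  up⊥-least j (A ⇒ B) (_ , _ , lf)          = λ g dg → up⊥-least j B (lf _ g (L-down j A dg))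

  up⊥≤up⊤ : ∀ j A {d} → D j A d → Le (suc j) A (up false j A d) (up true j A d)
  up⊥≤up⊤ j A dd = up⊥-least j A (L-up true j A dd)

  down-cong : ∀ j A {e e′} → Eq (suc j) A e e′ → Eq j A (down j A e) (down j A e′)
  down-cong j A eq = Le-antisym j A (down-mono j A (Eq⇒Le (suc j) A eq)) (down-mono j A (Eq⇒Ge (suc j) A eq))

  pointwise : (Subset n → Subset n → Subset n) → ∀ A → Sem n A → Sem n A → Sem n A
  pointwise _∙_ o       = _∙_
  pointwise _∙_ (A ⇒ B) = λ f g x → pointwise _∙_ B (f x) (g x)

  module Pointwise (_∙_ : Subset n → Subset n → Subset n)
    (∙-mono : ∀ {P P′ R R′} → P ⊆ R → P′ ⊆ R′ → P ∙ P′ ⊆ R ∙ R′)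
    (∙⊆∪ : ∀ {P P′} → P ∙ P′ ⊆ P ∪ P′)
    (∩-distribʳ-∙ : ∀ Q P P′ → (P ∙ P′) ∩ Q ≡ (P ∩ Q) ∙ (P′ ∩ Q))
    where

    ∙-D : ∀ k {P P′} → D k o P → D k o P′ → D k o (P ∙ P′)
    ∙-D k {P} {P′} dP dP′ q q∈ with x∈p∪q⁻ P P′ (∙⊆∪ q∈)
    ... | inj₁ q∈P = dP q q∈P
    ... | inj₂ q∈P′ = dP′ q q∈P′

    ∙-L : ∀ j {R P R′ P′} → L j o R P → L j o R′ P′ → L j o (R ∙ R′) (P ∙ P′)
    ∙-L j {P = P} {P′ = P′} lP lP′ =
      Lˡ-resp-Eq j o (trans (∩-distribʳ-∙ (Q≤ j) P P′)
                            (sym (cong₂ _∙_ (down-unique j o lP) (down-unique j o lP′))))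
                     (L-down j o (∙-D (suc j) (L⇒Dʳ j o lP) (L⇒Dʳ j o lP′)))

    pointwise-mono : ∀ k A {x x′ y y′} → Le k A x y → Le k A x′ y′ →
                     Le k A (pointwise _∙_ A x x′) (pointwise _∙_ A y y′)
    pointwise-mono k o       x≤y x′≤y′ = ∙-mono x≤y x′≤y′
    pointwise-mono k (A ⇒ B) f≤g f′≤g′ = λ z dz → pointwise-mono k B (f≤g z dz) (f′≤g′ z dz)

    mutual
      pointwise-D : ∀ k A {x y} → D k A x → D k A y → D k A (pointwise _∙_ A x y)
      pointwise-D k       o       dx dy = ∙-D k dx dy
      pointwise-D zero    (A ⇒ B) df dg = pointwise-MonoMap zero A B df dg
      pointwise-D (suc k) (A ⇒ B) (f₁ , lf) (g₁ , lg) =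
        pointwise _∙_ (A ⇒ B) f₁ g₁ , pointwise-L k (A ⇒ B) lf lg

      pointwise-MonoMap : ∀ k A B {f g} → MonoMap k A B f → MonoMap k A B g →
                          MonoMap k A B (pointwise _∙_ (A ⇒ B) f g)
      pointwise-MonoMap k A B (f-D , f-Le) (g-D , g-Le) =
        (λ x dx → pointwise-D k B (f-D x dx) (g-D x dx)) ,
        (λ x y dx dy x≤y → pointwise-mono k B (f-Le x y dx dy x≤y) (g-Le x y dx dy x≤y))

      pointwise-L : ∀ j A {x x′ y y′} → L j A x y → L j A x′ y′ →
                    L j A (pointwise _∙_ A x x′) (pointwise _∙_ A y y′)
      pointwise-L j o       l l′ = ∙-L j l l′
      pointwise-L j (A ⇒ B) (df , mf , lf) (df′ , mf′ , lf′) =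
        pointwise-D j (A ⇒ B) df df′ , pointwise-MonoMap (suc j) A B mf mf′ ,
        λ g₁ g₂ lg → pointwise-L j B (lf g₁ g₂ lg) (lf′ g₁ g₂ lg)

  join meet : ∀ A → Sem n A → Sem n A → Sem n A
  join = pointwise _∪_
  meet = pointwise _∩_

  module Join = Pointwise _∪_ ∪-mono (λ q∈ → q∈) (λ Q P P′ → ∩-distribʳ-∪ Q P P′)
  module Meet = Pointwise _∩_ ∩-mono (λ {P} {P′} q∈ → x∈p∪q⁺ (inj₁ (p∩q⊆p P P′ q∈)))
                         ∩-distribʳ-∩

  join-upperˡ : ∀ k A {x y} → Le k A x (join A x y)
  join-upperˡ k o       {y = y} = p⊆p∪q y
  join-upperˡ k (A ⇒ B)         = λ _ _ → join-upperˡ k B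

  join-upperʳ : ∀ k A {x y} → Le k A y (join A x y)
  join-upperʳ k o       {x} {y} = q⊆p∪q x y
  join-upperʳ k (A ⇒ B)         = λ _ _ → join-upperʳ k B

  join-least : ∀ k A {x y z} → Le k A x z → Le k A y z → Le k A (join A x y) z
  join-least k o {x} {y} x⊆z y⊆z q∈ with x∈p∪q⁻ x y q∈
  ... | inj₁ q∈x = x⊆z q∈x
  ... | inj₂ q∈y = y⊆z q∈y
  join-least k (A ⇒ B) f≤h g≤h = λ z dz → join-least k B (f≤h z dz) (g≤h z dz)

  meet-lowerˡ : ∀ k A {x y} → Le k A (meet A x y) x
  meet-lowerˡ k o       {x} {y} = p∩q⊆p x y
  meet-lowerˡ k (A ⇒ B)         = λ _ _ → meet-lowerˡ k B

  meet-lowerʳ : ∀ k A {x y} → Le k A (meet A x y) y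
  meet-lowerʳ k o       {x} {y} = p∩q⊆q x y
  meet-lowerʳ k (A ⇒ B)         = λ _ _ → meet-lowerʳ k B

  meet-greatest : ∀ k A {x y z} → Le k A z x → Le k A z y → Le k A z (meet A x y)
  meet-greatest k o       z⊆x z⊆y q∈ = x∈p∩q⁺ (z⊆x q∈ , z⊆y q∈)
  meet-greatest k (A ⇒ B) h≤f h≤g = λ z dz → meet-greatest k B (h≤f z dz) (h≤g z dz)

  bot : ∀ A → Sem n A
  bot o       = ∅
  bot (A ⇒ B) = λ _ → bot B

  bot-least : ∀ k A {x} → Le k A (bot A) x
  bot-least k o       q∈ = contradiction q∈ ∉⊥
  bot-least k (A ⇒ B)    = λ _ _ → bot-least k B

  top : ℕ → ∀ A → Sem n A
  top k o       = Q≤ k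
  top k (A ⇒ B) = λ _ → top k B

  top-greatest : ∀ k A {x} → D k A x → Le k A x (top k A)
  top-greatest k o       dx {q} q∈ = ∈Q≤⁺ (dx q q∈)
  top-greatest k (A ⇒ B) df        = λ x dx → top-greatest k B (app-D k A B df dx)

  mutual
    bot-D : ∀ k A → D k A (bot A)
    bot-D k       o       = λ q q∈ → contradiction q∈ ∉⊥
    bot-D zero    (A ⇒ B) = (λ _ _ → bot-D zero B) , (λ _ _ _ _ _ → Le-refl zero B (bot B))
    bot-D (suc k) (A ⇒ B) = bot (A ⇒ B) , bot-L k (A ⇒ B)

    bot-L : ∀ j A → L j A (bot A) (bot A)
    bot-L j o       = Lˡ-resp-Eq j o
      (⊆-antisym (λ q∈ → contradiction (proj₁ (x∈p∩q⁻ ∅ _ q∈)) ∉⊥) (λ q∈ → contradiction q∈ ∉⊥))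
      (L-down j o (bot-D (suc j) o))
    bot-L j (A ⇒ B) = bot-D j (A ⇒ B) ,
                      ((λ _ _ → bot-D (suc j) B) , (λ _ _ _ _ _ → Le-refl (suc j) B (bot B))) ,
                      λ _ _ _ → bot-L j B

  mutual
    top-D : ∀ k A → D k A (top k A)
    top-D k       o       = λ q → ∈Q≤⁻
    top-D zero    (A ⇒ B) = (λ _ _ → top-D zero B) , (λ _ _ _ _ _ → Le-refl zero B (top zero B))
    top-D (suc k) (A ⇒ B) = top k (A ⇒ B) , top-L k (A ⇒ B)

    top-L : ∀ j A → L j A (top j A) (top (suc j) A)
    top-L j o       = Lˡ-resp-Eq j o
      (⊆-antisym (λ q∈ → ∈Q≤⁺ (∈Q≤⁻ (proj₂ (x∈p∩q⁻ (Q≤ (suc j)) _ q∈))))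
                 (λ q∈ → x∈p∩q⁺ (∈Q≤⁺ (ℕ.m≤n⇒m≤1+n (∈Q≤⁻ q∈)) , q∈)))
      (L-down j o (top-D (suc j) o))
    top-L j (A ⇒ B) = top-D j (A ⇒ B) ,
                      ((λ _ _ → top-D (suc j) B) , (λ _ _ _ _ _ → Le-refl (suc j) B (top (suc j) B))) ,
                      λ _ _ _ → top-L j B

  interval⇒L : ∀ j A {d w} → D j A d → D (suc j) A w →
               Le (suc j) A (up false j A d) w → Le (suc j) A w (up true j A d) → L j A d w
  interval⇒L j o {d} {w} dd dw d⊆w w⊆d↑ = dd , dw , λ q → mk⇔ (λ q∈d → d⊆w q∈d , dd q q∈d) below
    where
    below : ∀ {q} → q ∈ w × ρ q ≤ j → q ∈ d
    below (q∈w , ρq≤j) with x∈p∪q⁻ d (Q≡ (suc j)) (w⊆d↑ q∈w)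
    ... | inj₁ q∈d = q∈d
    ... | inj₂ q∈Q = contradiction q∈Q (ρ≤⇒∉Q≡suc ρq≤j)
  interval⇒L j (A ⇒ B) {d} {w} dd (w₁ , lw) d↓≤w w≤d↑ = dd , proj₁ (proj₂ lw) , λ g₁ g₂ lg →
    let dg₂ = L⇒Dʳ j A lg in
    L-via-down j A B dd lg (interval⇒L j B (app-D j A B dd (down-D j A dg₂)) (app-D (suc j) A B (w₁ , lw) dg₂)
                      (d↓≤w g₂ dg₂) (w≤d↑ g₂ dg₂))

  -- Projection of e onto the interval [d↑⊥, d↑⊤], which is exactly {e : (d , e) ∈ L^{j+1}}.
  clamp : ∀ j A → Sem n A → Sem n A → Sem n A
  clamp j A d e = meet A (join A (up false j A d) e) (up true j A d)

  clamp-D : ∀ j A {d e} → D j A d → D (suc j) A e → D (suc j) A (clamp j A d e)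
  clamp-D j A dd de = Meet.pointwise-D (suc j) A
    (Join.pointwise-D (suc j) A (L⇒Dʳ j A (L-up false j A dd)) de) (L⇒Dʳ j A (L-up true j A dd))

  clamp-L : ∀ j A {d e} → D j A d → D (suc j) A e → L j A d (clamp j A d e)
  clamp-L j A dd de = interval⇒L j A dd (clamp-D j A dd de)
    (meet-greatest (suc j) A (join-upperˡ (suc j) A) (up⊥≤up⊤ j A dd)) (meet-lowerʳ (suc j) A)

  clamp-id : ∀ j A {d e} → Le (suc j) A (up false j A d) e → Le (suc j) A e (up true j A d) →
             Eq (suc j) A (clamp j A d e) e
  clamp-id j A d↓≤e e≤d↑ = Le-antisym (suc j) A
    (Le-trans (suc j) A (meet-lowerˡ (suc j) A) (join-least (suc j) A d↓≤e (Le-refl (suc j) A _)))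
    (meet-greatest (suc j) A (join-upperʳ (suc j) A) e≤d↑)

  clamp-mono : ∀ j A {d d′ e e′} → Le j A d d′ → Le (suc j) A e e′ →
               Le (suc j) A (clamp j A d e) (clamp j A d′ e′)
  clamp-mono j A d≤d′ e≤e′ = Meet.pointwise-mono (suc j) A
    (Join.pointwise-mono (suc j) A (up-mono false j A d≤d′) e≤e′) (up-mono true j A d≤d′)

  L-clamp : ∀ j A B {d e} → D j (A ⇒ B) d → MonoMap (suc j) A B e →
            L j (A ⇒ B) d (λ g → clamp j B (d (down j A g)) (e g))
  L-clamp j A B {d} {e} dd (e-D , e-Le) = dd , (clamped-D , clamped-Le) , λ g₁ g₂ lg →
    L-via-down j A B dd lg (clamp-L j B (d↓-D (L⇒Dʳ j A lg)) (e-D g₂ (L⇒Dʳ j A lg)))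
    where
    d↓-D : ∀ {g} → D (suc j) A g → D j B (d (down j A g))
    d↓-D dg = app-D j A B dd (down-D j A dg)
    clamped-D : ∀ g → D (suc j) A g → D (suc j) B (clamp j B (d (down j A g)) (e g))
    clamped-D g dg = clamp-D j B (d↓-D dg) (e-D g dg)
    clamped-Le : ∀ g g′ → D (suc j) A g → D (suc j) A g′ → Le (suc j) A g g′ →
                 Le (suc j) B (clamp j B (d (down j A g)) (e g)) (clamp j B (d (down j A g′)) (e g′))
    clamped-Le g g′ dg dg′ g≤g′ = clamp-mono j B
      (app-Le j A B dd (down-D j A dg) (down-D j A dg′) (down-mono j A g≤g′)) (e-Le g g′ dg dg′ g≤g′)

  bigJoin : ∀ A m → (Fin m → Sem n A) → Sem n A
  bigJoin A zero    s = bot A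
  bigJoin A (suc m) s = join A (s zero) (bigJoin A m (λ i → s (suc i)))

  bigJoin-upper : ∀ k A m s i → Le k A (s i) (bigJoin A m s)
  bigJoin-upper k A (suc m) s zero    = join-upperˡ k A
  bigJoin-upper k A (suc m) s (suc i) = Le-trans k A (bigJoin-upper k A m _ i) (join-upperʳ k A)

  bigJoin-least : ∀ k A m s {z} → (∀ i → Le k A (s i) z) → Le k A (bigJoin A m s) z
  bigJoin-least k A zero    s s≤z = bot-least k A
  bigJoin-least k A (suc m) s s≤z = join-least k A (s≤z zero) (bigJoin-least k A m _ (λ i → s≤z (suc i)))

  bigJoin-D : ∀ k A m s → (∀ i → D k A (s i)) → D k A (bigJoin A m s)
  bigJoin-D k A zero    s ds = bot-D k A
  bigJoin-D k A (suc m) s ds = Join.pointwise-D k A (ds zero) (bigJoin-D k A m _ (λ i → ds (suc i)))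

  bigJoin-mono : ∀ k A m s s′ → (∀ i → Le k A (s i) (s′ i)) → Le k A (bigJoin A m s) (bigJoin A m s′)
  bigJoin-mono k A m s s′ s≤s′ = bigJoin-least k A m s (λ i → Le-trans k A (s≤s′ i) (bigJoin-upper k A m s′ i))

  size : Ty → ℕ
  size o       = 2 ^ n
  size (A ⇒ B) = size B ^ size A

  -- elem k A enumerates D^k_A up to Eq, code k A picks an index for each element,
  -- and LeOn k A is the order of D^k_A tested only on enumerated arguments.  At level
  -- j+1 a step function is clamped into the L-fibre over an enumerated element of
  -- D^j, which is what puts it into D^{j+1}.
  mutual
    elem : ∀ k A → Fin (size A) → Sem n A
    elem k       o       c = SubsetCode.decode c ∩ Q≤ k
    elem zero    (A ⇒ B) t = stepFun zero A B t
    elem (suc j) (A ⇒ B) t = λ g →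
      clamp j B (elem j (A ⇒ B) (code j (A ⇒ B) (down j (A ⇒ B) (stepFun (suc j) A B t))) (down j A g))
                (stepFun (suc j) A B t g)

    -- the least monotone map sending each enumerated a to at least the b listed for it in t
    stepFun : ∀ k A B → Fin (size (A ⇒ B)) → Sem n (A ⇒ B)
    stepFun k A B t x = bigJoin B (size A) (λ i → step k A B t x i)

    step : ∀ k A B → Fin (size (A ⇒ B)) → Sem n A → Fin (size A) → Sem n B
    step k A B t x i = if does (LeOn? k A (elem k A i) x) then elem k B (finToFun t i) else bot B

    code : ∀ k A → Sem n A → Fin (size A)
    code k o       P = SubsetCode.encode P
    code k (A ⇒ B) f = funToFin (λ i → code k B (f (elem k A i)))

    LeOn : ∀ k A → Sem n A → Sem n A → Set
    LeOn k o       P P′ = P ⊆ P′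
    LeOn k (A ⇒ B) f g  = ∀ i → LeOn k B (f (elem k A i)) (g (elem k A i))

    LeOn? : ∀ k A x y → Dec (LeOn k A x y)
    LeOn? k o       P P′ = P ⊆? P′
    LeOn? k (A ⇒ B) f g  = all? (λ i → LeOn? k B (f (elem k A i)) (g (elem k A i)))

  record Enumerates (k : ℕ) (A : Ty) : Set where
    field
      elem-D    : ∀ c → D k A (elem k A c)
      elem-code : ∀ {x} → D k A x → Eq k A (elem k A (code k A x)) x
      code-cong : ∀ {x y} → Eq k A x y → code k A x ≡ code k A y
      LeOn⇒Le   : ∀ {x y} → D k A x → D k A y → LeOn k A x y → Le k A x y
      Le⇒LeOn   : ∀ {x y} → Le k A x y → LeOn k A x y

  module EnumeratesArrow k A B (EA : Enumerates k A) (EB : Enumerates k B) where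
    module EA = Enumerates EA
    module EB = Enumerates EB

    elem-code-app : ∀ {f} → MonoMap k A B f → ∀ {x} → D k A x → Eq k B (f (elem k A (code k A x))) (f x)
    elem-code-app (f-D , f-Le) dx = Le-antisym k B
      (f-Le _ _ (EA.elem-D _) dx (Eq⇒Le k A (EA.elem-code dx)))
      (f-Le _ _ dx (EA.elem-D _) (Eq⇒Ge k A (EA.elem-code dx)))

    table-code : ∀ f i → elem k B (finToFun (code k (A ⇒ B) f) i) ≡ elem k B (code k B (f (elem k A i)))
    table-code f i = cong (elem k B) (finToFun-funToFin _ i)

    step-D : ∀ t x i → D k B (step k A B t x i)
    step-D t x i with LeOn? k A (elem k A i) x
    ... | yes _ = EB.elem-D _
    ... | no _  = bot-D k B

    step-mono : ∀ t {x y} i → D k A x → Le k A x y → Le k B (step k A B t x i) (step k A B t y i)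
    step-mono t {x} {y} i dx x≤y with LeOn? k A (elem k A i) x | LeOn? k A (elem k A i) y
    ... | yes _   | yes _   = Le-refl k B _
    ... | yes e≤x | no e≰y  = contradiction (EA.Le⇒LeOn (Le-trans k A (EA.LeOn⇒Le (EA.elem-D i) dx e≤x) x≤y)) e≰y
    ... | no _    | _       = bot-least k B

    stepFun-MonoMap : ∀ t → MonoMap k A B (stepFun k A B t)
    stepFun-MonoMap t =
      (λ x _ → bigJoin-D k B (size A) _ (step-D t x)) ,
      (λ x y dx _ x≤y → bigJoin-mono k B (size A) _ _ (λ i → step-mono t i dx x≤y))

    step-below : ∀ {f} → MonoMap k A B f → ∀ {x} → D k A x →
                 ∀ i → Le k B (step k A B (code k (A ⇒ B) f) x i) (f x)
    step-below {f} mf {x} dx i with LeOn? k A (elem k A i) x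
    ... | no _    = bot-least k B
    ... | yes e≤x = begin
        elem k B (finToFun (code k (A ⇒ B) f) i)  ≡⟨ table-code f i ⟩
        elem k B (code k B (f (elem k A i)))      ≈⟨ EB.elem-code (proj₁ mf _ (EA.elem-D i)) ⟩
        f (elem k A i)                            ≤⟨ proj₂ mf _ _ (EA.elem-D i) dx
                                                       (EA.LeOn⇒Le (EA.elem-D i) dx e≤x) ⟩
        f x                                       ∎
      where open Le-Reasoning k B

    step-at-code : ∀ {f} → MonoMap k A B f → ∀ {x} → D k A x →
                   Le k B (f x) (step k A B (code k (A ⇒ B) f) x (code k A x))
    step-at-code {f} mf {x} dx with LeOn? k A (elem k A (code k A x)) x
    ... | no e≰x = contradiction (EA.Le⇒LeOn (Eq⇒Le k A (EA.elem-code dx))) e≰x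
    ... | yes _  = begin
        f x                                                 ≈⟨ elem-code-app mf dx ⟨
        f (elem k A (code k A x))                           ≈⟨ EB.elem-code (proj₁ mf _ (EA.elem-D _)) ⟨
        elem k B (code k B (f (elem k A (code k A x))))     ≡⟨ table-code f (code k A x) ⟨
        elem k B (finToFun (code k (A ⇒ B) f) (code k A x)) ∎
      where open Le-Reasoning k B

    stepFun-code : ∀ {f} → MonoMap k A B f → Eq k (A ⇒ B) (stepFun k A B (code k (A ⇒ B) f)) f
    stepFun-code mf x dx = Le-antisym k B
      (bigJoin-least k B (size A) _ (step-below mf dx))
      (Le-trans k B (step-at-code mf dx) (bigJoin-upper k B (size A) _ (code k A x)))

    code-cong : ∀ {f g} → Eq k (A ⇒ B) f g → code k (A ⇒ B) f ≡ code k (A ⇒ B) g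
    code-cong f≈g = funToFin-cong (λ i → EB.code-cong (f≈g _ (EA.elem-D i)))

    LeOn⇒Le : ∀ {f g} → D k (A ⇒ B) f → D k (A ⇒ B) g → LeOn k (A ⇒ B) f g → Le k (A ⇒ B) f g
    LeOn⇒Le {f} {g} df dg f≤g x dx = begin
        f x                        ≈⟨ app-Eq k A B df dx (EA.elem-D _) (Eq-sym k A (EA.elem-code dx)) ⟩
        f (elem k A (code k A x))  ≤⟨ EB.LeOn⇒Le (app-D k A B df (EA.elem-D _))
                                                 (app-D k A B dg (EA.elem-D _)) (f≤g _) ⟩
        g (elem k A (code k A x))  ≈⟨ app-Eq k A B dg (EA.elem-D _) dx (EA.elem-code dx) ⟩
        g x                        ∎
      where open Le-Reasoning k B

    Le⇒LeOn : ∀ {f g} → Le k (A ⇒ B) f g → LeOn k (A ⇒ B) f g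
    Le⇒LeOn f≤g i = EB.Le⇒LeOn (f≤g _ (EA.elem-D i))

  enumerates-o : ∀ k → Enumerates k o
  enumerates-o k = record
    { elem-D    = λ c q q∈ → ∈Q≤⁻ (proj₂ (x∈p∩q⁻ (SubsetCode.decode c) _ q∈))
    ; elem-code = λ {P} dP → trans (cong (_∩ Q≤ k) (SubsetCode.decode-encode P)) (restrict-id dP)
    ; code-cong = cong SubsetCode.encode
    ; LeOn⇒Le   = λ _ _ P⊆P′ → P⊆P′
    ; Le⇒LeOn   = λ P⊆P′ → P⊆P′
    }
    where
    restrict-id : ∀ {P} → D k o P → P ∩ Q≤ k ≡ P
    restrict-id {P} dP = ⊆-antisym (p∩q⊆p P _) (λ {q} q∈ → x∈p∩q⁺ (q∈ , ∈Q≤⁺ (dP q q∈)))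

  enumerates-⇒₀ : ∀ A B → Enumerates zero A → Enumerates zero B → Enumerates zero (A ⇒ B)
  enumerates-⇒₀ A B EA EB = record
    { elem-D = stepFun-MonoMap ; elem-code = stepFun-code ; code-cong = code-cong
    ; LeOn⇒Le = LeOn⇒Le ; Le⇒LeOn = Le⇒LeOn }
    where open EnumeratesArrow zero A B EA EB

  enumerates-⇒ₛ : ∀ j A B → Enumerates (suc j) A → Enumerates (suc j) B → Enumerates j (A ⇒ B) →
                  Enumerates (suc j) (A ⇒ B)
  enumerates-⇒ₛ j A B EA EB EAB = record
    { elem-D = λ t → _ , L-clamp j A B (EAB.elem-D _) (stepFun-MonoMap t) ; elem-code = elem-code
    ; code-cong = code-cong ; LeOn⇒Le = LeOn⇒Le ; Le⇒LeOn = Le⇒LeOn }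
    where
    open EnumeratesArrow (suc j) A B EA EB
    module EAB = Enumerates EAB
    elem-code : ∀ {f} → D (suc j) (A ⇒ B) f → Eq (suc j) (A ⇒ B) (elem (suc j) (A ⇒ B) (code (suc j) (A ⇒ B) f)) f
    -- f lies in the interval over f↓ ≈ d, where clamping is the identity.
    elem-code {f} (f₁ , lf) g dg = Eq-trans (suc j) B (clamp-id j B d↓≤e e≤d↑) (e≈f g dg)
      where
      e = stepFun (suc j) A B (code (suc j) (A ⇒ B) f)
      e≈f : Eq (suc j) (A ⇒ B) e f
      e≈f = stepFun-code (proj₁ (proj₂ lf))
      d = elem j (A ⇒ B) (code j (A ⇒ B) (down j (A ⇒ B) e))
      d≈f₁ : Eq j (A ⇒ B) d f₁
      d≈f₁ = ≡.subst (λ c → Eq j (A ⇒ B) (elem j (A ⇒ B) c) f₁)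
        (sym (EAB.code-cong (Eq-trans j (A ⇒ B) (down-cong j (A ⇒ B) e≈f)
                                                (Eq-sym j (A ⇒ B) (down-unique j (A ⇒ B) lf)))))
        (EAB.elem-code (L⇒Dˡ j (A ⇒ B) lf))
      l : L j B (d (down j A g)) (f g)
      l = Lˡ-resp-Eq j B (Eq-sym j B (d≈f₁ _ (down-D j A dg))) (L-app j A B lf (L-down j A dg))
      d↓≤e = Le-trans (suc j) B (up⊥-least j B l) (Eq⇒Ge (suc j) B (e≈f g dg))
      e≤d↑ = Le-trans (suc j) B (Eq⇒Le (suc j) B (e≈f g dg)) (up⊤-greatest j B l)

  enumerates : ∀ k A → Enumerates k A
  enumerates k       o       = enumerates-o k
  enumerates zero    (A ⇒ B) = enumerates-⇒₀ A B (enumerates zero A) (enumerates zero B)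
  enumerates (suc j) (A ⇒ B) = enumerates-⇒ₛ j A B (enumerates (suc j) A) (enumerates (suc j) B) (enumerates j (A ⇒ B))

  elem-D : ∀ k A c → D k A (elem k A c)
  elem-D k A = Enumerates.elem-D (enumerates k A)

  elem-code : ∀ k A {x} → D k A x → Eq k A (elem k A (code k A x)) x
  elem-code k A = Enumerates.elem-code (enumerates k A)

  measure : ∀ k A → Sem n A → ℕ
  measure k o       P = ∣ P ∣
  measure k (A ⇒ B) f = sumᶠ (size A) (λ i → measure k B (f (elem k A i)))

  measure-mono : ∀ k A {x y} → D k A x → D k A y → Le k A x y → measure k A x ≤ measure k A y
  measure-mono k o       _  _  P⊆P′ = p⊆q⇒∣p∣≤∣q∣ P⊆P′
  measure-mono k (A ⇒ B) df dg f≤g  = sumᶠ-mono (size A) λ i →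
    measure-mono k B (app-D k A B df (elem-D k A i)) (app-D k A B dg (elem-D k A i)) (f≤g _ (elem-D k A i))

  Le∧measure≡⇒Ge : ∀ k A {x y} → D k A x → D k A y → Le k A x y → measure k A x ≡ measure k A y → Le k A y x
  Le∧measure≡⇒Ge k o       _  _  P⊆P′ eq = ⊆∧∣≡∣⇒⊇ P⊆P′ eq
  Le∧measure≡⇒Ge k (A ⇒ B) {f} {g} df dg f≤g eq z dz = begin
      g z   ≈⟨ app-Eq k A B dg dz (elem-D k A _) (Eq-sym k A (elem-code k A dz)) ⟩
      g e   ≤⟨ Le∧measure≡⇒Ge k B (fe-D _) (ge-D _) (f≤g _ (elem-D k A _))
                 (sumᶠ-≡⇒≡ (size A) (λ i → measure-mono k B (fe-D i) (ge-D i) (f≤g _ (elem-D k A i)))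
                           eq (code k A z)) ⟩
      f e   ≈⟨ app-Eq k A B df (elem-D k A _) dz (elem-code k A dz) ⟩
      f z   ∎
    where
    open Le-Reasoning k B
    e = elem k A (code k A z)
    fe-D = λ i → app-D k A B df (elem-D k A i)
    ge-D = λ i → app-D k A B dg (elem-D k A i)

  bound : ℕ → Ty → ℕ
  bound k A = measure k A (top k A)

  measure≤bound : ∀ k A {x} → D k A x → measure k A x ≤ bound k A
  measure≤bound k A dx = measure-mono k A dx (top-D k A) (top-greatest k A dx)

  iter-D : ∀ k A {f z} → D k (A ⇒ A) f → D k A z → ∀ i → D k A (iter f i z)
  iter-D k A df dz zero    = dz
  iter-D k A df dz (suc i) = app-D k A A df (iter-D k A df dz i)

  iter-mono : ∀ k A {f g z z′} → D k (A ⇒ A) f → D k (A ⇒ A) g → Le k (A ⇒ A) f g →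
              D k A z → D k A z′ → Le k A z z′ → ∀ i → Le k A (iter f i z) (iter g i z′)
  iter-mono k A df dg f≤g dz dz′ z≤z′ zero    = z≤z′
  iter-mono k A df dg f≤g dz dz′ z≤z′ (suc i) =
    Le-trans k A (app-Le k A A df (iter-D k A df dz i) (iter-D k A dg dz′ i) (iter-mono k A df dg f≤g dz dz′ z≤z′ i))
                 (f≤g _ (iter-D k A dg dz′ i))

  iter-cong : ∀ k A {f z z′} → D k (A ⇒ A) f → D k A z → D k A z′ → Eq k A z z′ →
              ∀ i → Eq k A (iter f i z) (iter f i z′)
  iter-cong k A df dz dz′ z≈z′ i = Le-antisym k A
    (iter-mono k A df df (λ x _ → Le-refl k A _) dz dz′ (Eq⇒Le k A z≈z′) i)
    (iter-mono k A df df (λ x _ → Le-refl k A _) dz′ dz (Eq⇒Ge k A z≈z′) i)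

  -- From a post- or pre-fixpoint z the iterates form a monotone chain along which the
  -- measure moves strictly until the chain is constant, so it is constant from step
  -- bound k A on.
  module Iteration k A {f z} (df : D k (A ⇒ A) f) (dz : D k A z) where

    limit : Sem n A
    limit = iter f (bound k A) z

    chain-D : ∀ i → D k A (iter f i z)
    chain-D = iter-D k A df dz

    limit-D : D k A limit
    limit-D = chain-D (bound k A)

    module Descending (fz≤z : Le k A (f z) z) where

      descending : ∀ i → Le k A (iter f (suc i) z) (iter f i z)
      descending zero    = fz≤z
      descending (suc i) = app-Le k A A df (chain-D (suc i)) (chain-D i) (descending i)

      open Stabilisation (Le k A) (Le-refl k A _) (Le-trans k A)
        (measure k A) (λ i → iter f i z) descending
        (λ i → measure-mono k A (chain-D (suc i)) (chain-D i) (descending i))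
        (λ i → Le∧measure≡⇒Ge k A (chain-D (suc i)) (chain-D i) (descending i))
        (λ i → app-Le k A A df (chain-D i) (chain-D (suc i)))

      limit-GLB : IsGLB k A (λ i → iter f i z) limit
      limit-GLB = limit-D , limit-below (bound k A) (measure≤bound k A dz) , λ _ _ y≤ → y≤ (bound k A)

      limit-fixed : Eq k A (f limit) limit
      limit-fixed = Le-antisym k A (descending (bound k A)) (stable-after (bound k A) (measure≤bound k A dz))

    module Ascending (z≤fz : Le k A z (f z)) where

      ascending : ∀ i → Le k A (iter f i z) (iter f (suc i) z)
      ascending zero    = z≤fz
      ascending (suc i) = app-Le k A A df (chain-D i) (chain-D (suc i)) (ascending i)

      co-measure : Sem n A → ℕ
      co-measure x = bound k A ∸ measure k A x

      measure-≡ : ∀ i → co-measure (iter f (suc i) z) ≡ co-measure (iter f i z) →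
                  measure k A (iter f i z) ≡ measure k A (iter f (suc i) z)
      measure-≡ i = sym ∘ ℕ.∸-cancelˡ-≡ (measure≤bound k A (chain-D (suc i))) (measure≤bound k A (chain-D i))

      open Stabilisation (λ x y → Le k A y x) (Le-refl k A _) (λ p q → Le-trans k A q p)
        co-measure (λ i → iter f i z) ascending
        (λ i → ℕ.∸-monoʳ-≤ (bound k A) (measure-mono k A (chain-D i) (chain-D (suc i)) (ascending i)))
        (λ i eq → Le∧measure≡⇒Ge k A (chain-D i) (chain-D (suc i)) (ascending i) (measure-≡ i eq))
        (λ i → app-Le k A A df (chain-D (suc i)) (chain-D i))

      co-measure-start : co-measure z ≤ bound k A
      co-measure-start = ℕ.m∸n≤m (bound k A) (measure k A z)

      limit-LUB : IsLUB k A (λ i → iter f i z) limit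
      limit-LUB = limit-D , limit-below (bound k A) co-measure-start , λ _ _ ≤y → ≤y (bound k A)

      limit-fixed : Eq k A (f limit) limit
      limit-fixed = Le-antisym k A (stable-after (bound k A) co-measure-start) (ascending (bound k A))

  GLB-unique : ∀ k A {s s′ x x′} → IsGLB k A s x → IsGLB k A s′ x′ →
               (∀ i → Eq k A (s i) (s′ i)) → Eq k A x x′
  GLB-unique k A (x-D , x≤ , ≤x) (x′-D , x′≤ , ≤x′) s≈s′ = Le-antisym k A
    (≤x′ _ x-D (λ i → Le-trans k A (x≤ i) (Eq⇒Le k A (s≈s′ i))))
    (≤x _ x′-D (λ i → Le-trans k A (x′≤ i) (Eq⇒Ge k A (s≈s′ i))))

  LUB-unique : ∀ k A {s s′ x x′} → IsLUB k A s x → IsLUB k A s′ x′ →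
               (∀ i → Eq k A (s i) (s′ i)) → Eq k A x x′
  LUB-unique k A (x-D , ≤x , x≤) (x′-D , ≤x′ , x′≤) s≈s′ = Le-antisym k A
    (x≤ _ x′-D (λ i → Le-trans k A (Eq⇒Le k A (s≈s′ i)) (≤x′ i)))
    (x′≤ _ x-D (λ i → Le-trans k A (Eq⇒Ge k A (s≈s′ i)) (≤x i)))

  -- The last component of IsFix (suc j): how x is obtained from y = fix^j(f↓).
  FixAbove : Bool → ℕ → ∀ A → Sem n (A ⇒ A) → Sem n A → Sem n A → Set
  FixAbove b j A f y x =
    if b then (Σ (Sem n A) λ z → IsUpTop j A y z × IsGLB (suc j) A (λ i → iter f i z) x)
         else (Σ (Sem n A) λ z → IsUpBot j A y z × IsLUB (suc j) A (λ i → iter f i z) x)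

  fix : ℕ → ∀ A → Sem n (A ⇒ A) → Sem n A
  fix zero    A f = iter f (bound zero A) (top zero A)
  fix (suc j) A f = iter f (bound (suc j) A) (up (isEven (suc j)) j A (fix j A (down j (A ⇒ A) f)))

  module Lift j A {f} (df : D (suc j) (A ⇒ A) f) {y} (y-D : D j A y) (y-fixed : Eq j A (down j (A ⇒ A) f y) y) where

    step-L : ∀ {w} → L j A y w → L j A y (f w)
    step-L l = Lˡ-resp-Eq j A y-fixed (L-app j A A (L-down j (A ⇒ A) df) l)

    start-D : ∀ b → D (suc j) A (up b j A y)
    start-D b = L⇒Dʳ j A (L-up b j A y-D)

    chain-L : ∀ b i → L j A y (iter f i (up b j A y))
    chain-L b zero    = L-up b j A y-D
    chain-L b (suc i) = step-L (chain-L b i)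

    module It b = Iteration (suc j) A df (start-D b)
    module Desc = It.Descending true (up⊤-greatest j A (step-L (L-up true j A y-D)))
    module Asc  = It.Ascending false (up⊥-least j A (step-L (L-up false j A y-D)))

    limit-fixed : ∀ b → Eq (suc j) A (f (It.limit b)) (It.limit b)
    limit-fixed true  = Desc.limit-fixed
    limit-fixed false = Asc.limit-fixed

    fixAbove : ∀ b → FixAbove b j A f y (It.limit b)
    fixAbove true  = up true j A y , (L-up true j A y-D , λ _ → up⊤-greatest j A) , Desc.limit-GLB
    fixAbove false = up false j A y , (L-up false j A y-D , λ _ → up⊥-least j A) , Asc.limit-LUB

    fixAbove-unique : ∀ b {y′ x} → Eq j A y′ y → FixAbove b j A f y′ x → Eq (suc j) A x (It.limit b)
    fixAbove-unique true y′≈y (z , (lz , z-greatest) , glb) = GLB-unique (suc j) A glb Desc.limit-GLB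
      (iter-cong (suc j) A df (L⇒Dʳ j A lz) (start-D true)
        (Le-antisym (suc j) A (up⊤-greatest j A (Lˡ-resp-Eq j A y′≈y lz))
                              (z-greatest _ (Lˡ-resp-Eq j A (Eq-sym j A y′≈y) (L-up true j A y-D)))))
    fixAbove-unique false y′≈y (z , (lz , z-least) , lub) = LUB-unique (suc j) A lub Asc.limit-LUB
      (iter-cong (suc j) A df (L⇒Dʳ j A lz) (start-D false)
        (Le-antisym (suc j) A (z-least _ (Lˡ-resp-Eq j A (Eq-sym j A y′≈y) (L-up false j A y-D)))
                              (up⊥-least j A (Lˡ-resp-Eq j A y′≈y lz))))

  module Base A {f} (df : D zero (A ⇒ A) f) where
    open Iteration zero A df (top-D zero A) public
    open Descending (top-greatest zero A (app-D zero A A df (top-D zero A))) public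

  mutual
    fix-D : ∀ k A {f} → D k (A ⇒ A) f → D k A (fix k A f)
    fix-D zero    A df = Base.limit-D A df
    fix-D (suc j) A df = Lift.It.limit-D j A df (fix-D j A df↓) (fix-fixed j A df↓) _
      where df↓ = down-D j (A ⇒ A) df

    fix-fixed : ∀ k A {f} → D k (A ⇒ A) f → Eq k A (f (fix k A f)) (fix k A f)
    fix-fixed zero    A df = Base.limit-fixed A df
    fix-fixed (suc j) A df = Lift.limit-fixed j A df (fix-D j A df↓) (fix-fixed j A df↓) _
      where df↓ = down-D j (A ⇒ A) df

  module Above j A {f} (df : D (suc j) (A ⇒ A) f) =
    Lift j A df (fix-D j A (down-D j (A ⇒ A) df)) (fix-fixed j A (down-D j (A ⇒ A) df))

  fix-mono : ∀ k A {f g} → D k (A ⇒ A) f → D k (A ⇒ A) g → Le k (A ⇒ A) f g → Le k A (fix k A f) (fix k A g)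
  fix-mono zero    A df dg f≤g = iter-mono zero A df dg f≤g (top-D zero A) (top-D zero A) (Le-refl zero A _) (bound zero A)
  fix-mono (suc j) A df dg f≤g = iter-mono (suc j) A df dg f≤g (Above.start-D j A df _) (Above.start-D j A dg _)
    (up-mono _ j A (fix-mono j A (down-D j (A ⇒ A) df) (down-D j (A ⇒ A) dg) (down-mono j (A ⇒ A) f≤g)))
    (bound (suc j) A)

  fix-cong : ∀ k A {f g} → D k (A ⇒ A) f → D k (A ⇒ A) g → Eq k (A ⇒ A) f g → Eq k A (fix k A f) (fix k A g)
  fix-cong k A df dg f≈g =
    Le-antisym k A (fix-mono k A df dg (Eq⇒Le k (A ⇒ A) f≈g)) (fix-mono k A dg df (Eq⇒Ge k (A ⇒ A) f≈g))

  fix-IsFix : ∀ k A {f} → D k (A ⇒ A) f → IsFix k A f (fix k A f)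
  fix-IsFix zero    A df = top zero A , (top-D zero A , λ _ → top-greatest zero A) , Base.limit-GLB A df
  fix-IsFix (suc j) A {f} df =
    down j (A ⇒ A) f , L-down j (A ⇒ A) df ,
    fix j A (down j (A ⇒ A) f) , fix-IsFix j A (down-D j (A ⇒ A) df) ,
    Above.fixAbove j A df _

  IsFix-unique : ∀ k A {f x} → D k (A ⇒ A) f → IsFix k A f x → Eq k A x (fix k A f)
  IsFix-unique zero A df (t , (t-D , t-greatest) , glb) = GLB-unique zero A glb (Base.limit-GLB A df)
    (iter-cong zero A df t-D (top-D zero A) (Le-antisym zero A (top-greatest zero A t-D) (t-greatest _ (top-D zero A))))
  IsFix-unique (suc j) A {f} df (f↓ , lf↓ , y , y-IsFix , above) = Above.fixAbove-unique j A df _ y≈ above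
    where
    f↓-D = L⇒Dˡ j (A ⇒ A) lf↓
    y≈ : Eq j A y (fix j A (down j (A ⇒ A) f))
    y≈ = Eq-trans j A (IsFix-unique j A f↓-D y-IsFix)
                      (fix-cong j A f↓-D (down-D j (A ⇒ A) df) (down-unique j (A ⇒ A) lf↓))

  fix-L : ∀ j A {f₁ f₂} → L j (A ⇒ A) f₁ f₂ → L j A (fix j A f₁) (fix (suc j) A f₂)
  fix-L j A lf = Lˡ-resp-Eq j A y≈ (Above.chain-L j A (L⇒Dʳ j (A ⇒ A) lf) _ (bound (suc j) A))
    where
    y≈ = fix-cong j A (down-D j (A ⇒ A) (L⇒Dʳ j (A ⇒ A) lf)) (L⇒Dˡ j (A ⇒ A) lf)
                      (Eq-sym j (A ⇒ A) (down-unique j (A ⇒ A) lf))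

  fix∈D : ∀ k A → D k ((A ⇒ A) ⇒ A) (fix k A)
  fix∈D zero    A = (λ _ → fix-D zero A) , (λ _ _ → fix-mono zero A)
  fix∈D (suc j) A =
    fix j A , fix∈D j A , ((λ _ → fix-D (suc j) A) , (λ _ _ → fix-mono (suc j) A)) , λ _ _ → fix-L j A

  module _ {k} {Yint : (A : Ty) → Sem n ((A ⇒ A) ⇒ A)} (Y-IsFix : YSpec k Yint) where

    YSpec⇒≈fix : ∀ A {f} → D k (A ⇒ A) f → Eq k A (Yint A f) (fix k A f)
    YSpec⇒≈fix A df = IsFix-unique k A df (Y-IsFix A _ df)

    YSpec⇒D : ∀ A → D k ((A ⇒ A) ⇒ A) (Yint A)
    YSpec⇒D A = D-resp-Eq k ((A ⇒ A) ⇒ A) (λ f df → Eq-sym k A (YSpec⇒≈fix A df)) (fix∈D k A)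

    YSpec⇒fixed : ∀ A {f} → D k (A ⇒ A) f → Eq k A (Yint A f) (f (Yint A f))
    YSpec⇒fixed A {f} df = begin-equality
      Yint A f          ≈⟨ YSpec⇒≈fix A df ⟩
      fix k A f         ≈⟨ fix-fixed k A df ⟨
      f (fix k A f)     ≈⟨ app-Eq k A A df (fix-D k A df) (app-D k ((A ⇒ A)) A (YSpec⇒D A) df)
                                  (Eq-sym k A (YSpec⇒≈fix A df)) ⟩
      f (Yint A f)      ∎
      where open Le-Reasoning k A

module Semantics (n : ℕ) (ρ : Fin n → ℕ) (Const : Set) (cty : Const → Ty) where
  open Model n ρ
  open Domain n ρ
  open Syntax Const cty

  Consts : Set
  Consts = (c : Const) → Sem n (cty c)

  Fixes : Set
  Fixes = (A : Ty) → Sem n ((A ⇒ A) ⇒ A)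

  Valid : ℕ → Consts → Fixes → Set
  Valid k ci yi = (∀ c → D k (cty c) (ci c)) × (∀ A → D k ((A ⇒ A) ⇒ A) (yi A))

  module Environments (ci : Consts) (yi : Fixes) (k : ℕ) where
    open Interp n Const cty ci yi

    EnvD : ∀ {Γ} → Env Γ → Set
    EnvD {Γ} ν = ∀ {B} (x : Γ ∋ B) → D k B (ν x)

    EnvLe : ∀ {Γ} → Env Γ → Env Γ → Set
    EnvLe {Γ} ν ν′ = ∀ {B} (x : Γ ∋ B) → Le k B (ν x) (ν′ x)

    EnvEq : ∀ {Γ} → Env Γ → Env Γ → Set
    EnvEq {Γ} ν ν′ = ∀ {B} (x : Γ ∋ B) → Eq k B (ν x) (ν′ x)

    EnvLe-refl : ∀ {Γ} (ν : Env Γ) → EnvLe ν ν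
    EnvLe-refl ν {B} x = Le-refl k B (ν x)

    ▸-D : ∀ {Γ A} {ν : Env Γ} {p} → EnvD ν → D k A p → EnvD (ν ▸ p)
    ▸-D dν dp here      = dp
    ▸-D dν dp (there x) = dν x

    ▸-Le : ∀ {Γ A} {ν ν′ : Env Γ} {p p′} → EnvLe ν ν′ → Le k A p p′ → EnvLe (ν ▸ p) (ν′ ▸ p′)
    ▸-Le ν≤ν′ p≤p′ here      = p≤p′
    ▸-Le ν≤ν′ p≤p′ (there x) = ν≤ν′ x

  InterpretsInD : ℕ → Set
  InterpretsInD k = ∀ ci yi → Valid k ci yi →
    ∀ {Γ A} (M : Tm Γ A) (ν : Interp.Env n Const cty ci yi Γ) →
    Environments.EnvD ci yi k ν → D k A (Interp.⟦_⟧ n Const cty ci yi M ν)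

  module Level₀ (ci : Consts) (yi : Fixes) (valid : Valid zero ci yi) where
    open Interp n Const cty ci yi
    open Environments ci yi zero

    mutual
      ⟦⟧-D : ∀ {Γ A} (M : Tm Γ A) {ν : Env Γ} → EnvD ν → D zero A (⟦ M ⟧ ν)
      ⟦⟧-D (var x)           dν = dν x
      ⟦⟧-D (con c)           dν = proj₁ valid c
      ⟦⟧-D (Y A)             dν = proj₂ valid A
      ⟦⟧-D (app {A} {B} M N) dν = app-D zero A B (⟦⟧-D M dν) (⟦⟧-D N dν)
      ⟦⟧-D (lam M) {ν} dν =
        (λ p dp → ⟦⟧-D M (▸-D dν dp)) ,
        (λ p p′ dp dp′ p≤p′ → ⟦⟧-mono M (▸-D dν dp) (▸-D dν dp′) (▸-Le (EnvLe-refl ν) p≤p′))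

      ⟦⟧-mono : ∀ {Γ A} (M : Tm Γ A) {ν ν′ : Env Γ} → EnvD ν → EnvD ν′ → EnvLe ν ν′ →
                Le zero A (⟦ M ⟧ ν) (⟦ M ⟧ ν′)
      ⟦⟧-mono (var x)           dν dν′ ν≤ν′ = ν≤ν′ x
      ⟦⟧-mono (con c)           dν dν′ ν≤ν′ = Le-refl zero (cty c) (ci c)
      ⟦⟧-mono (Y A)             dν dν′ ν≤ν′ = Le-refl zero ((A ⇒ A) ⇒ A) (yi A)
      ⟦⟧-mono (app {A} {B} M N) dν dν′ ν≤ν′ =
        Le-trans zero B
          (app-Le zero A B (⟦⟧-D M dν) (⟦⟧-D N dν) (⟦⟧-D N dν′) (⟦⟧-mono N dν dν′ ν≤ν′))
          (⟦⟧-mono M dν dν′ ν≤ν′ _ (⟦⟧-D N dν′))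
      ⟦⟧-mono (lam {A} M)       dν dν′ ν≤ν′ = λ p dp →
        ⟦⟧-mono M (▸-D dν dp) (▸-D dν′ dp) (▸-Le ν≤ν′ (Le-refl zero A p))

  -- At level j+1 the interpretation is related by L to the one at level j
  -- interpreting every constant c by (ci c)↓.
  module Levelₛ (j : ℕ) (⟦⟧-Dⱼ : InterpretsInD j)
                (ci : Consts) (yi : Fixes) (valid : Valid (suc j) ci yi) where
    open Interp n Const cty ci yi
    open Environments ci yi (suc j)

    ci↓ : Consts
    ci↓ c = down j (cty c) (ci c)

    yi↓ : Fixes
    yi↓ A = down j ((A ⇒ A) ⇒ A) (yi A)

    valid↓ : Valid j ci↓ yi↓
    valid↓ = (λ c → down-D j (cty c) (proj₁ valid c)) , (λ A → down-D j ((A ⇒ A) ⇒ A) (proj₂ valid A))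

    module I↓ = Interp n Const cty ci↓ yi↓

    EnvL : ∀ {Γ} → I↓.Env Γ → Env Γ → Set
    EnvL {Γ} ν₁ ν₂ = ∀ {B} (x : Γ ∋ B) → L j B (ν₁ x) (ν₂ x)

    ▸-L : ∀ {Γ A} {ν₁ : I↓.Env Γ} {ν₂ : Env Γ} {p₁ p₂} → EnvL ν₁ ν₂ → L j A p₁ p₂ →
          EnvL (ν₁ I↓.▸ p₁) (ν₂ ▸ p₂)
    ▸-L ν₁~ν₂ lp here      = lp
    ▸-L ν₁~ν₂ lp (there x) = ν₁~ν₂ x

    mutual
      ⟦⟧-L : ∀ {Γ A} (M : Tm Γ A) {ν₁ : I↓.Env Γ} {ν₂ : Env Γ} → EnvL ν₁ ν₂ →
             L j A (I↓.⟦ M ⟧ ν₁) (⟦ M ⟧ ν₂)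
      ⟦⟧-L (var x)           ν₁~ν₂ = ν₁~ν₂ x
      ⟦⟧-L (con c)           ν₁~ν₂ = L-down j (cty c) (proj₁ valid c)
      ⟦⟧-L (Y A)             ν₁~ν₂ = L-down j ((A ⇒ A) ⇒ A) (proj₂ valid A)
      ⟦⟧-L (app {A} {B} M N) ν₁~ν₂ = L-app j A B (⟦⟧-L M ν₁~ν₂) (⟦⟧-L N ν₁~ν₂)
      ⟦⟧-L (lam M) {ν₁} {ν₂} ν₁~ν₂ =
        ⟦⟧-Dⱼ ci↓ yi↓ valid↓ (lam M) ν₁ (λ x → L⇒Dˡ j _ (ν₁~ν₂ x)) ,
        ((λ p dp → ⟦⟧-D M (▸-D dν₂ dp)) ,
         (λ p p′ dp dp′ p≤p′ →
            ⟦⟧-mono M (▸-D dν₂ dp) (▸-D dν₂ dp′) (▸-Le (EnvLe-refl ν₂) p≤p′))) ,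
        λ g₁ g₂ lg → ⟦⟧-L M (▸-L ν₁~ν₂ lg)
        where
        dν₂ : EnvD ν₂
        dν₂ x = L⇒Dʳ j _ (ν₁~ν₂ x)

      ⟦⟧-D : ∀ {Γ A} (M : Tm Γ A) {ν : Env Γ} → EnvD ν → D (suc j) A (⟦ M ⟧ ν)
      ⟦⟧-D {A = A} M {ν} dν =
        L⇒Dʳ j A (⟦⟧-L M {ν₁ = λ {B} x → down j B (ν x)} (λ x → L-down j _ (dν x)))

      ⟦⟧-mono : ∀ {Γ A} (M : Tm Γ A) {ν ν′ : Env Γ} → EnvD ν → EnvD ν′ → EnvLe ν ν′ →
                Le (suc j) A (⟦ M ⟧ ν) (⟦ M ⟧ ν′)
      ⟦⟧-mono (var x)           dν dν′ ν≤ν′ = ν≤ν′ x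
      ⟦⟧-mono (con c)           dν dν′ ν≤ν′ = Le-refl (suc j) (cty c) (ci c)
      ⟦⟧-mono (Y A)             dν dν′ ν≤ν′ = Le-refl (suc j) ((A ⇒ A) ⇒ A) (yi A)
      ⟦⟧-mono (app {A} {B} M N) dν dν′ ν≤ν′ =
        Le-trans (suc j) B
          (app-Le (suc j) A B (⟦⟧-D M dν) (⟦⟧-D N dν) (⟦⟧-D N dν′) (⟦⟧-mono N dν dν′ ν≤ν′))
          (⟦⟧-mono M dν dν′ ν≤ν′ _ (⟦⟧-D N dν′))
      ⟦⟧-mono (lam {A} M)       dν dν′ ν≤ν′ = λ p dp →
        ⟦⟧-mono M (▸-D dν dp) (▸-D dν′ dp) (▸-Le ν≤ν′ (Le-refl (suc j) A p))

  ⟦⟧-D : ∀ k → InterpretsInD k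
  ⟦⟧-D zero    ci yi valid M ν dν = Level₀.⟦⟧-D ci yi valid M dν
  ⟦⟧-D (suc j) ci yi valid M ν dν = Levelₛ.⟦⟧-D j (⟦⟧-D j) ci yi valid M dν

  ⟦⟧-mono : ∀ k ci yi → Valid k ci yi → ∀ {Γ A} (M : Tm Γ A) {ν ν′ : Interp.Env n Const cty ci yi Γ} →
            Environments.EnvD ci yi k ν → Environments.EnvD ci yi k ν′ → Environments.EnvLe ci yi k ν ν′ →
            Le k A (Interp.⟦_⟧ n Const cty ci yi M ν) (Interp.⟦_⟧ n Const cty ci yi M ν′)
  ⟦⟧-mono zero    ci yi valid = Level₀.⟦⟧-mono ci yi valid
  ⟦⟧-mono (suc j) ci yi valid = Levelₛ.⟦⟧-mono j (⟦⟧-D j) ci yi valid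

  module Soundness (k : ℕ) (ci : Consts) (yi : Fixes) (valid : Valid k ci yi)
                   (yi-fixed : ∀ A {f} → D k (A ⇒ A) f → Eq k A (yi A f) (f (yi A f))) where
    open Interp n Const cty ci yi
    open Environments ci yi k

    ⟦_⟧-D : ∀ {Γ A} (M : Tm Γ A) {ν : Env Γ} → EnvD ν → D k A (⟦ M ⟧ ν)
    ⟦ M ⟧-D = ⟦⟧-D k ci yi valid M _

    ⟦⟧-cong : ∀ {Γ A} (M : Tm Γ A) {ν ν′ : Env Γ} → EnvD ν → EnvD ν′ → EnvEq ν ν′ →
              Eq k A (⟦ M ⟧ ν) (⟦ M ⟧ ν′)
    ⟦⟧-cong {A = A} M dν dν′ ν≈ν′ = Le-antisym k A
      (⟦⟧-mono k ci yi valid M dν dν′ (λ x → Eq⇒Le k _ (ν≈ν′ x)))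
      (⟦⟧-mono k ci yi valid M dν′ dν (λ x → Eq⇒Ge k _ (ν≈ν′ x)))

    ⟦rename⟧ : ∀ {Γ Δ A} (r : Ren Γ Δ) (M : Tm Γ A) {ν : Env Δ} → EnvD ν →
               Eq k A (⟦ rename r M ⟧ ν) (⟦ M ⟧ (λ x → ν (r x)))
    ⟦rename⟧ r (var x)           dν = Eq-refl k _ _
    ⟦rename⟧ r (con c)           dν = Eq-refl k _ _
    ⟦rename⟧ r (Y A)             dν = Eq-refl k _ _
    ⟦rename⟧ r (app {A} {B} M N) {ν} dν =
      app-cong k A B (⟦ M ⟧-D dν∘r) (⟦ rename r N ⟧-D dν) (⟦ N ⟧-D dν∘r) (⟦rename⟧ r M dν) (⟦rename⟧ r N dν)
      where
      dν∘r : EnvD (λ x → ν (r x))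
      dν∘r x = dν (r x)
    ⟦rename⟧ r (lam M) {ν} dν = λ p dp →
      Eq-trans k _ (⟦rename⟧ (extR r) M (▸-D dν dp))
                   (⟦⟧-cong M (λ x → ▸-D dν dp (extR r x)) (▸-D (λ x → dν (r x)) dp) (ext-Eq p))
      where
      ext-Eq : ∀ p → EnvEq (λ x → (ν ▸ p) (extR r x)) ((λ x → ν (r x)) ▸ p)
      ext-Eq p here      = Eq-refl k _ _
      ext-Eq p (there x) = Eq-refl k _ _

    ⟦subst⟧ : ∀ {Γ Δ A} (σ : Sub Γ Δ) (M : Tm Γ A) {ν : Env Δ} → EnvD ν →
              Eq k A (⟦ subst σ M ⟧ ν) (⟦ M ⟧ (λ x → ⟦ σ x ⟧ ν))
    ⟦subst⟧ σ (var x)           dν = Eq-refl k _ _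
    ⟦subst⟧ σ (con c)           dν = Eq-refl k _ _
    ⟦subst⟧ σ (Y A)             dν = Eq-refl k _ _
    ⟦subst⟧ σ (app {A} {B} M N) {ν} dν =
      app-cong k A B (⟦ M ⟧-D σ-D) (⟦ subst σ N ⟧-D dν) (⟦ N ⟧-D σ-D) (⟦subst⟧ σ M dν) (⟦subst⟧ σ N dν)
      where
      σ-D : EnvD (λ x → ⟦ σ x ⟧ ν)
      σ-D x = ⟦ σ x ⟧-D dν
    ⟦subst⟧ σ (lam {A} M) {ν} dν = λ p dp →
      Eq-trans k _ (⟦subst⟧ (extS σ) M (▸-D dν dp))
                   (⟦⟧-cong M (λ x → ⟦ extS σ x ⟧-D (▸-D dν dp)) (▸-D (λ x → ⟦ σ x ⟧-D dν) dp)
                              (ext-Eq dp))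
      where
      ext-Eq : ∀ {p} → D k A p → EnvEq (λ x → ⟦ extS σ x ⟧ (ν ▸ p)) ((λ x → ⟦ σ x ⟧ ν) ▸ p)
      ext-Eq dp here      = Eq-refl k _ _
      ext-Eq dp (there x) = ⟦rename⟧ there (σ x) (▸-D dν dp)

    ⟦β⟧ : ∀ {Γ A B} (M : Tm (A ∷ Γ) B) (N : Tm Γ A) {ν : Env Γ} → EnvD ν →
          Eq k B (⟦ M [ N ] ⟧ ν) (⟦ M ⟧ (ν ▸ ⟦ N ⟧ ν))
    ⟦β⟧ M N {ν} dν = Eq-trans k _ (⟦subst⟧ (single N) M dν)
      (⟦⟧-cong M (λ x → ⟦ single N x ⟧-D dν) (▸-D dν (⟦ N ⟧-D dν)) single-Eq)
      where
      single-Eq : EnvEq (λ x → ⟦ single N x ⟧ ν) (ν ▸ ⟦ N ⟧ ν)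
      single-Eq here      = Eq-refl k _ _
      single-Eq (there x) = Eq-refl k _ _

    sound : ∀ {Γ A} {M N : Tm Γ A} → M =βδ N → ∀ {ν : Env Γ} → EnvD ν → Eq k A (⟦ M ⟧ ν) (⟦ N ⟧ ν)
    sound (β M N)     dν = Eq-sym k _ (⟦β⟧ M N dν)
    sound (δ {A} M)   dν = yi-fixed A (⟦ M ⟧-D dν)
    sound refl        dν = Eq-refl k _ _
    sound (sym p)     dν = Eq-sym k _ (sound p dν)
    sound (trans p q) dν = Eq-trans k _ (sound p dν) (sound q dν)
    sound (appCong {A} {B} {M} {M′} {N} {N′} p q) dν =
      app-cong k A B (⟦ M′ ⟧-D dν) (⟦ N ⟧-D dν) (⟦ N′ ⟧-D dν) (sound p dν) (sound q dν)
    sound (lamCong p) dν = λ x dx → sound p (▸-D dν dx)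


theorem4p12 : (n : ℕ) (ρ : Fin n → ℕ) (k : ℕ) → k ≤ maxρ n ρ →
    (Const : Set) (cty : Const → Ty) (cint : (c : Const) → Sem n (cty c)) →
    (∀ c → Model.D n ρ k (cty c) (cint c)) →
    Σ ((A : Ty) → Sem n ((A ⇒ A) ⇒ A)) (λ Yint → Model.YSpec n ρ k Yint)
    ×
    ((Yint : (A : Ty) → Sem n ((A ⇒ A) ⇒ A)) → Model.YSpec n ρ k Yint →
      ((Γ : List Ty) (A : Ty) (M : Syntax.Tm Const cty Γ A)
        (ν : Interp.Env n Const cty cint Yint Γ) →
        (∀ {B} (x : Γ ∋ B) → Model.D n ρ k B (ν x)) →
        Model.D n ρ k A (Interp.⟦_⟧ n Const cty cint Yint M ν))
      ×
      ((Γ : List Ty) (A : Ty) (M N : Syntax.Tm Const cty Γ A) →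
        Syntax._=βδ_ Const cty M N →
        (ν : Interp.Env n Const cty cint Yint Γ) →
        (∀ {B} (x : Γ ∋ B) → Model.D n ρ k B (ν x)) →
        Model.Eq n ρ k A (Interp.⟦_⟧ n Const cty cint Yint M ν)
                         (Interp.⟦_⟧ n Const cty cint Yint N ν)))
theorem4p12 n ρ k _ Const cty cint cint-D =
  (fix k , λ A f → fix-IsFix k A) ,
  λ Yint Y-IsFix →
    let valid = cint-D , YSpec⇒D Y-IsFix
    in (λ Γ A M ν → ⟦⟧-D k cint Yint valid M ν) ,
       (λ Γ A M N M=N ν → Soundness.sound k cint Yint valid (YSpec⇒fixed Y-IsFix) M=N)
  where
  open Domain n ρ
  open Semantics n ρ Const cty
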